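{- \begin{enumerate} \item Suppose $w\in\mathfrak{S}_n$. Then $\mathcal{R}_w$ is a $2$-chain if and only if $w$ is a Coxeter element of $\mathfrak{S}_n$. \item Every $n$-element $2$-chain is isomorphic to $\mathcal{R}_w$ for some Coxeter element $w\in\mathfrak{S}_n$. \item Suppose $v$ and $w$ are Coxeter elements of $\mathfrak{S}_n$. Then $\mathcal{R}_v\cong\mathcal{R}_w$ if and only if $v\in\{w,w^{ -1}\}$. \end{enumerate}
   Context: All posets are finite; partial orders are written $\preceq$. A poset $(P,\preceq)$ is a $2$-chain if (1) there is a unique way to write $P$ as the union of two chains, and (2) $\preceq$ is maximal subject to (1), i.e. for every proper refinement $\preceq^+$ of $\preceq$ there is more than one way to write $P$ as the union of two $\preceq^+$-chains. $\mathfrak{S}_n$ is the symmetric group on $\{1,\dots,n\}$ with Coxeter generators $s_i=(i,i+1)$, $1\le i\le n-1$; a Coxeter element is a product of the generators $s_1,\dots,s_{n-1}$, each appearing exactly once, in some order. For $w\in\mathfrak{S}_n$, $\mathcal{R}_w$ is the set $\{1,\dots,n\}$ with $i\preceq j$ if and only if $i\leq j$ and $w(i)\leq w(j)$. -}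

module Defs where

open import Level using (0ℓ)
open import Data.Nat.Base using (ℕ; zero; suc)
open import Data.Fin.Base using (Fin; inject₁; suc) renaming (_≤_ to _≤ᶠ_)
open import Data.Fin.Properties using (_≤?_)
open import Data.Fin.Permutation using (Permutation′; _⟨$⟩ʳ_; _≈_; id; transpose; _∘ₚ_)
open import Data.Bool.Base using (Bool; not)
open import Data.List.Base using (List; []; _∷_; allFin)
open import Data.List.Relation.Binary.Permutation.Propositional using (_↭_)
open import Data.Product.Base using (Σ; ∃; ∃₂; _×_; _,_)
open import Data.Sum.Base using (_⊎_)
open import Data.Unit.Base using (⊤)
open import Function.Bundles using (_↔_; Inverse)
open import Relation.Binary.Core using (Rel)
open import Relation.Binary.Definitions using (Decidable)
open import Relation.Binary.Structures using (IsPartialOrder)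
open import Relation.Binary.PropositionalEquality using (_≡_)
open import Relation.Nullary using (¬_; _×-dec_)

record FinPoset : Set₁ where
  field
    Carrier        : Set
    _≼_            : Rel Carrier 0ℓ
    isPartialOrder : IsPartialOrder _≡_ _≼_
    _≼?_           : Decidable _≼_

record PartialOrderOn (A : Set) : Set₁ where
  field
    _≼_            : Rel A 0ℓ
    isPartialOrder : IsPartialOrder _≡_ _≼_
    _≼?_           : Decidable _≼_

-- A way of writing A as a union of two (disjoint, possibly empty)
-- chains {C₀, C₁} is encoded by a colouring χ : A → Bool, with
-- C₀ = χ⁻¹(false), C₁ = χ⁻¹(true); the pair is unordered, so χ and
-- not ∘ χ describe the same way.

Comparable : {A : Set} → Rel A 0ℓ → A → A → Set
Comparable _≼_ x y = (x ≼ y) ⊎ (y ≼ x)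

IsTwoChainDecomposition : {A : Set} → Rel A 0ℓ → (A → Bool) → Set
IsTwoChainDecomposition {A} _≼_ χ = (x y : A) → χ x ≡ χ y → Comparable _≼_ x y

SameWay : {A : Set} → (A → Bool) → (A → Bool) → Set
SameWay {A} χ χ′ = ((x : A) → χ′ x ≡ χ x) ⊎ ((x : A) → χ′ x ≡ not (χ x))

UniqueTwoChainDecomposition : {A : Set} → Rel A 0ℓ → Set
UniqueTwoChainDecomposition {A} _≼_ =
  Σ (A → Bool) λ χ → IsTwoChainDecomposition _≼_ χ ×
    ((χ′ : A → Bool) → IsTwoChainDecomposition _≼_ χ′ → SameWay χ χ′)

SeveralTwoChainDecompositions : {A : Set} → Rel A 0ℓ → Set
SeveralTwoChainDecompositions {A} _≼_ =
  Σ (A → Bool) λ χ → Σ (A → Bool) λ χ′ →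
    IsTwoChainDecomposition _≼_ χ × IsTwoChainDecomposition _≼_ χ′ × ¬ SameWay χ χ′

ProperRefinement : {A : Set} → Rel A 0ℓ → Rel A 0ℓ → Set
ProperRefinement {A} _≼_ _≼⁺_ =
  ({x y : A} → x ≼ y → x ≼⁺ y) × ∃₂ λ (x y : A) → (x ≼⁺ y) × ¬ (x ≼ y)

IsTwoChain : FinPoset → Set₁
IsTwoChain P =
  UniqueTwoChainDecomposition _≼_ ×
  ((Q : PartialOrderOn Carrier) → ProperRefinement _≼_ (PartialOrderOn._≼_ Q) →
     SeveralTwoChainDecompositions (PartialOrderOn._≼_ Q))
  where open FinPoset P

record _≅_ (P Q : FinPoset) : Set where
  private
    module P = FinPoset P
    module Q = FinPoset Q
  field
    bij       : P.Carrier ↔ Q.Carrier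
    preserves : (x y : P.Carrier) → x P.≼ y → Inverse.to bij x Q.≼ Inverse.to bij y
    reflects  : (x y : P.Carrier) → Inverse.to bij x Q.≼ Inverse.to bij y → x P.≼ y

-- The symmetric group: Coxeter generators and Coxeter elements.
-- For n = suc m, the generators are s_i = (i, i+1), indexed (0-based)
-- by i : Fin m, i.e. transposing inject₁ i and suc i.

s : {m : ℕ} → Fin m → Permutation′ (suc m)
s i = transpose (inject₁ i) (suc i)

prod : {m : ℕ} → List (Fin m) → Permutation′ (suc m)
prod []      = id
prod (i ∷ l) = s i ∘ₚ prod l

-- w is a product of the generators, each appearing exactly once.
-- (In 𝔖₀ there are no generators; the empty product is the identity,
-- the only element.)
IsCoxeterElement : (n : ℕ) → Permutation′ n → Set
IsCoxeterElement zero    w = ⊤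
IsCoxeterElement (suc m) w =
  Σ (List (Fin m)) λ l → (l ↭ allFin m) × (w ≈ prod l)

_≼ᴿ_ : {n : ℕ} → Permutation′ n → Rel (Fin n) 0ℓ
(w ≼ᴿ i) j = (i ≤ᶠ j) × ((w ⟨$⟩ʳ i) ≤ᶠ (w ⟨$⟩ʳ j))

module _ {n : ℕ} (w : Permutation′ n) where
  private
    open import Data.Fin.Properties as FP using ()
    open import Relation.Binary.PropositionalEquality using (refl)

    ≼ᴿ-isPartialOrder : IsPartialOrder _≡_ (w ≼ᴿ_)
    ≼ᴿ-isPartialOrder = record
      { isPreorder = record
        { isEquivalence = Relation.Binary.PropositionalEquality.isEquivalence
        ; reflexive = λ { refl → FP.≤-refl , FP.≤-refl }
        ; trans = λ { (a , b) (c , d) → FP.≤-trans a c , FP.≤-trans b d }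
        }
      ; antisym = λ { (a , _) (c , _) → FP.≤-antisym a c }
      }
      where import Relation.Binary.PropositionalEquality

    ≼ᴿ? : Decidable (w ≼ᴿ_)
    ≼ᴿ? i j = (i ≤? j) ×-dec ((w ⟨$⟩ʳ i) ≤? (w ⟨$⟩ʳ j))

  ℛ : FinPoset
  ℛ = record
    { Carrier = Fin n ; _≼_ = w ≼ᴿ_
    ; isPartialOrder = ≼ᴿ-isPartialOrder ; _≼?_ = ≼ᴿ? }

-- A Coxeter element of 𝔖ₙ₊₂ begins or ends with s₀ = (0 1), and removing it leaves a Coxeter
-- element on the points 1,…,n+1; on the poset side ℛ_w is obtained from the smaller ℛ by adjoining
-- a point comparable to all points but one, which preserves being a 2-chain.  Conversely, if ℛ_w
-- is a 2-chain then w avoids 321 (a decomposition exists), is indecomposable (the decomposition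
-- is unique) and has tight descents (maximality, refining ℛ_w at a descent), and these
-- properties let one peel off s₀ again.  Any 2-chain is the intersection of two linear extensions,
-- whose ranks give the positions and values of w.  Finally, an isomorphism ℛ_v ≅ ℛ_w must respect
-- the unique decomposition of ℛ_v, whose two chains consist of the points that are, and that are
-- not, the larger end of an inversion; this forces v = w or v = w⁻¹.
module Submission where

open import Defs
open import Level using (0ℓ)
open import Data.Bool.Base using (Bool; true; false; not; _xor_)
open import Data.Bool.Properties using (not-involutive; not-injective; not-¬; ¬-not; xor-annihilates-not)
  renaming (_≟_ to _≟ᵇ_)
open import Data.Empty using (⊥; ⊥-elim)
open import Data.Fin.Base as Fin using (Fin; zero; suc; toℕ; fromℕ<; inject₁; punchIn; punchOut)
open import Data.Fin.Patterns using (0F; 1F; 2F)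
open import Data.Fin.Properties
  using (_≤?_;_≟_; suc-injective; toℕ-injective; toℕ-fromℕ<; toℕ<n; any?; injective⇒≤; toℕ-inject≤; inject≤-injective;
         punchIn-injective; punchInᵢ≢i; punchOut-cong; punchOut-punchIn; punchIn-punchOut;
         punchIn-mono-≤; punchIn-cancel-≤; punchOut-injective)
open import Data.Fin.Permutation
  using (Permutation′; permutation; _⟨$⟩ʳ_; _⟨$⟩ˡ_; _≈_; id; flip; transpose; _∘ₚ_;
         remove; lift₀; lift₀-remove; lift₀-comp; lift₀-cong; lift₀-transpose; inverseˡ; inverseʳ)
open import Data.List.Base using (List; []; _∷_; _++_; [_]; map; allFin; tabulate; filter; length)
open import Data.List.Properties using (map-tabulate; ++-identityʳ; length-tabulate; filter-notAll)
open import Data.List.Membership.Propositional using (_∈_; _∉_)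
open import Data.List.Membership.Propositional.Properties using (∈-∃++; ∈-++⁺ˡ; ∈-++⁺ʳ; ∈-map⁻; ∈-tabulate⁺)
import Data.List.Membership.DecPropositional as DecMembership
open import Data.List.Relation.Unary.Any using (Any; here; there)
import Data.List.Relation.Unary.Any as Any
import Data.List.Relation.Unary.All as All
open import Data.List.Relation.Unary.Unique.Propositional using (Unique; _∷_)
import Data.List.Relation.Unary.Unique.Propositional.Properties as Unique
open import Data.List.Relation.Binary.Permutation.Propositional using (_↭_; ↭-sym; ↭-trans; ↭-refl; prep; ↭⇒↭ₛ)
open import Data.List.Relation.Binary.Permutation.Propositional.Properties
  using (map⁺; ↭-map-inv; drop-mid; shift; ∈-resp-↭)
import Data.List.Relation.Binary.Permutation.Setoid.Properties as PermutationSetoid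
open import Data.Nat.Base using (ℕ; zero; suc; z≤n; s≤s; _+_; _<_; _≤_; pred)
import Data.Nat.Properties as ℕ
open import Data.Product.Base using (Σ; ∃; _×_; _,_; proj₁; proj₂; uncurry)
import Data.Product.Base as Product
open import Data.Sum.Base using (_⊎_; inj₁; inj₂; swap)
import Data.Sum.Base as Sum
open import Data.Unit.Base using (⊤; tt)
open import Function.Base using (_∘′_; case_of_)
open import Function.Bundles using (_↔_; Inverse)
open import Function.Construct.Composition using (_↔-∘_)
open import Relation.Binary.Core using (Rel)
open import Relation.Binary.Structures using (IsPartialOrder)
open import Relation.Binary.PropositionalEquality
  using (_≡_; _≢_; refl; sym; trans; cong; cong₂; subst; subst₂; isEquivalence; setoid)
open import Relation.Binary.Definitions using (tri<; tri≈; tri>)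
open import Relation.Nullary using (¬_; yes; no; Dec; does; _×-dec_; _⊎-dec_; ¬?)
open import Relation.Nullary.Decidable using (dec-true; dec-false)

-- Two-chain orders

-- IsTwoChain P unfolds to TwoChainOrder (FinPoset._≼_ P).
TwoChainOrder : {A : Set} → Rel A 0ℓ → Set₁
TwoChainOrder {A} _≼_ =
  UniqueTwoChainDecomposition _≼_ ×
  ((Q : PartialOrderOn A) → ProperRefinement _≼_ (PartialOrderOn._≼_ Q) →
     SeveralTwoChainDecompositions (PartialOrderOn._≼_ Q))

sameWay-sym : {A : Set} {χ χ′ : A → Bool} → SameWay χ χ′ → SameWay χ′ χ
sameWay-sym (inj₁ h) = inj₁ λ x → sym (h x)
sameWay-sym {χ = χ} {χ′} (inj₂ h) = inj₂ λ x → trans (sym (not-involutive (χ x))) (cong not (sym (h x)))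

sameWay-trans : {A : Set} {χ₁ χ₂ χ₃ : A → Bool} → SameWay χ₁ χ₂ → SameWay χ₂ χ₃ → SameWay χ₁ χ₃
sameWay-trans (inj₁ h) (inj₁ h′) = inj₁ λ x → trans (h′ x) (h x)
sameWay-trans (inj₁ h) (inj₂ h′) = inj₂ λ x → trans (h′ x) (cong not (h x))
sameWay-trans (inj₂ h) (inj₁ h′) = inj₂ λ x → trans (h′ x) (h x)
sameWay-trans {χ₁ = χ₁} (inj₂ h) (inj₂ h′) = inj₁ λ x → trans (h′ x) (trans (cong not (h x)) (not-involutive (χ₁ x)))

pullbackOrder : {A B : Set} (f : A → B) → (∀ {x y} → f x ≡ f y → x ≡ y) →
                PartialOrderOn B → PartialOrderOn A
pullbackOrder f f-injective Q = record
  { _≼_ = λ x y → f x ⊑ f y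
  ; isPartialOrder = record
    { isPreorder = record
      { isEquivalence = isEquivalence
      ; reflexive = λ { refl → Q.refl }
      ; trans = Q.trans }
    ; antisym = λ p q → f-injective (Q.antisym p q) }
  ; _≼?_ = λ x y → f x ≼? f y }
  where
  open PartialOrderOn Q renaming (_≼_ to _⊑_)
  module Q = IsPartialOrder isPartialOrder

-- x must get the colour opposite to u's; a proper refinement either makes x and u comparable,
-- and then x may take either colour, or it refines the order on the other points.
module AdjoinPoint {k : ℕ} (_≼_ : Rel (Fin (suc k)) 0ℓ) (≼-refl : ∀ a → a ≼ a)
                   (_≼′_ : Rel (Fin k) 0ℓ) (x u : Fin (suc k)) (x≢u : x ≢ u)
                   (restrict : ∀ i j → punchIn x i ≼ punchIn x j → i ≼′ j)
                   (unrestrict : ∀ i j → i ≼′ j → punchIn x i ≼ punchIn x j)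
                   (x≁u : ¬ Comparable _≼_ x u)
                   (x∼others : ∀ z → z ≢ x → z ≢ u → Comparable _≼_ x z)
                   (twoChain′ : TwoChainOrder _≼′_) where

  private
    ι : Fin k → Fin (suc k)
    ι = punchIn x

    ι≢x : ∀ i → ι i ≢ x
    ι≢x = punchInᵢ≢i x

    data View : Fin (suc k) → Set where
      new : View x
      old : (i : Fin k) → View (ι i)

    view : ∀ z → View z
    view z with x ≟ z
    ... | yes refl = new
    ... | no x≢z = subst View (punchIn-punchOut x≢z) (old (punchOut x≢z))

    u′ : Fin k
    u′ = punchOut x≢u

    ιu′ : ι u′ ≡ u
    ιu′ = punchIn-punchOut x≢u

    extend : (Fin k → Bool) → Bool → Fin (suc k) → Bool
    extend χ b z with x ≟ z
    ... | yes _ = b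
    ... | no x≢z = χ (punchOut x≢z)

    extend-new : ∀ χ b → extend χ b x ≡ b
    extend-new χ b with x ≟ x
    ... | yes _ = refl
    ... | no x≢x = ⊥-elim (x≢x refl)

    extend-old : ∀ χ b i → extend χ b (ι i) ≡ χ i
    extend-old χ b i with x ≟ ι i
    ... | yes x≡ιi = ⊥-elim (ι≢x i (sym x≡ιi))
    ... | no _ = cong χ (trans (punchOut-cong x refl) (punchOut-punchIn x))

    extend-isDecomposition :
      (R : Rel (Fin (suc k)) 0ℓ) → (∀ a → R a a) → (χ : Fin k → Bool) (b : Bool) →
      (∀ i j → χ i ≡ χ j → Comparable R (ι i) (ι j)) →
      (∀ i → χ i ≡ b → Comparable R x (ι i)) →
      IsTwoChainDecomposition R (extend χ b)
    extend-isDecomposition R R-refl χ b old∼old new∼old y z e with view y | view z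
    ... | new | new = inj₁ (R-refl x)
    ... | new | old j = new∼old j (trans (sym (extend-old χ b j)) (trans (sym e) (extend-new χ b)))
    ... | old i | new = swap (new∼old i (trans (sym (extend-old χ b i)) (trans e (extend-new χ b))))
    ... | old i | old j = old∼old i j (trans (sym (extend-old χ b i)) (trans e (extend-old χ b j)))

    restrict-sameWay : ∀ χ₁ χ₂ b₁ b₂ → SameWay (extend χ₁ b₁) (extend χ₂ b₂) → SameWay χ₁ χ₂
    restrict-sameWay χ₁ χ₂ b₁ b₂ (inj₁ h) = inj₁ λ i →
      trans (sym (extend-old χ₂ b₂ i)) (trans (h (ι i)) (extend-old χ₁ b₁ i))
    restrict-sameWay χ₁ χ₂ b₁ b₂ (inj₂ h) = inj₂ λ i →
      trans (sym (extend-old χ₂ b₂ i)) (trans (h (ι i)) (cong not (extend-old χ₁ b₁ i)))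

    lift∼ : ∀ {i j} → Comparable _≼′_ i j → Comparable _≼_ (ι i) (ι j)
    lift∼ = Sum.map (unrestrict _ _) (unrestrict _ _)

    lower∼ : ∀ {i j} → Comparable _≼_ (ι i) (ι j) → Comparable _≼′_ i j
    lower∼ = Sum.map (restrict _ _) (restrict _ _)

    oppositeToU⇒≢u : ∀ (χ : Fin k → Bool) i → χ i ≡ not (χ u′) → ι i ≢ u
    oppositeToU⇒≢u χ i e ιi≡u = not-¬ refl
      (subst (λ t → χ t ≡ not (χ u′)) (punchIn-injective x i u′ (trans ιi≡u (sym ιu′))) e)

    χ′ : Fin k → Bool
    χ′ = proj₁ (proj₁ twoChain′)

    χ′-isDecomposition : IsTwoChainDecomposition _≼′_ χ′
    χ′-isDecomposition = proj₁ (proj₂ (proj₁ twoChain′))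

    χ′-unique : (ψ : Fin k → Bool) → IsTwoChainDecomposition _≼′_ ψ → SameWay χ′ ψ
    χ′-unique = proj₂ (proj₂ (proj₁ twoChain′))

    χ : Fin (suc k) → Bool
    χ = extend χ′ (not (χ′ u′))

    χ-isDecomposition : IsTwoChainDecomposition _≼_ χ
    χ-isDecomposition = extend-isDecomposition _≼_ ≼-refl χ′ (not (χ′ u′))
      (λ i j e → lift∼ (χ′-isDecomposition i j e))
      (λ i e → x∼others (ι i) (ι≢x i) (oppositeToU⇒≢u χ′ i e))

    colour-x : ∀ ψ → IsTwoChainDecomposition _≼_ ψ → ψ x ≡ not (ψ (ι u′))
    colour-x ψ ψ-isDecomposition =
      trans (¬-not (λ e → x≁u (ψ-isDecomposition x u e))) (cong (λ t → not (ψ t)) (sym ιu′))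

    χ-unique : (ψ : Fin (suc k) → Bool) → IsTwoChainDecomposition _≼_ ψ → SameWay χ ψ
    χ-unique ψ ψ-dec with χ′-unique (λ i → ψ (ι i)) (λ i j e → lower∼ (ψ-dec (ι i) (ι j) e))
    ... | inj₁ h = inj₁ λ z → agree z (view z)
      where
      agree : ∀ z → View z → ψ z ≡ χ z
      agree .x new = trans (colour-x ψ ψ-dec) (trans (cong not (h u′)) (sym (extend-new χ′ _)))
      agree .(ι i) (old i) = trans (h i) (sym (extend-old χ′ _ i))
    ... | inj₂ h = inj₂ λ z → disagree z (view z)
      where
      disagree : ∀ z → View z → ψ z ≡ not (χ z)
      disagree .x new = trans (colour-x ψ ψ-dec) (cong not (trans (h u′) (sym (extend-new χ′ _))))
      disagree .(ι i) (old i) = trans (h i) (cong not (sym (extend-old χ′ _ i)))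

    module Refined (Q : PartialOrderOn (Fin (suc k))) (refines : ProperRefinement _≼_ (PartialOrderOn._≼_ Q)) where
      open PartialOrderOn Q renaming (_≼_ to _⊑_)
      module Q = IsPartialOrder isPartialOrder

      weaken∼ : ∀ {a b} → Comparable _≼_ a b → Comparable _⊑_ a b
      weaken∼ = Sum.map (proj₁ refines) (proj₁ refines)

      x∼u⇒several : Comparable _⊑_ x u → SeveralTwoChainDecompositions _⊑_
      x∼u⇒several x∼u = extend χ′ true , extend χ′ false , isDecomposition true , isDecomposition false ,
                         distinct
        where
        x∼ : ∀ i → Comparable _⊑_ x (ι i)
        x∼ i with ι i ≟ u
        ... | yes ιi≡u = subst (Comparable _⊑_ x) (sym ιi≡u) x∼u
        ... | no ιi≢u = weaken∼ (x∼others (ι i) (ι≢x i) ιi≢u)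
        isDecomposition : ∀ b → IsTwoChainDecomposition _⊑_ (extend χ′ b)
        isDecomposition b = extend-isDecomposition _⊑_ (λ _ → Q.refl) χ′ b
          (λ i j e → weaken∼ (lift∼ (χ′-isDecomposition i j e))) (λ i _ → x∼ i)
        distinct : ¬ SameWay (extend χ′ true) (extend χ′ false)
        distinct (inj₁ h) with trans (sym (extend-new χ′ false)) (trans (h x) (extend-new χ′ true))
        ... | ()
        distinct (inj₂ h) = not-¬ refl
          (trans (sym (extend-old χ′ false u′)) (trans (h (ι u′)) (cong not (extend-old χ′ true u′))))

      old⊑old⇒several : ∀ i j → ι i ⊑ ι j → ¬ (ι i ≼ ι j) → SeveralTwoChainDecompositions _⊑_
      old⊑old⇒several i j ιi⊑ιj ιi⋠ιj
        with proj₂ twoChain′ (pullbackOrder ι (punchIn-injective x _ _) Q)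
               ((λ p → proj₁ refines (unrestrict _ _ p)) , i , j , ιi⊑ιj , (λ p → ιi⋠ιj (unrestrict _ _ p)))
      ... | χ₁ , χ₂ , χ₁-dec , χ₂-dec , χ₁≁χ₂ =
        extend χ₁ (not (χ₁ u′)) , extend χ₂ (not (χ₂ u′)) , isDecomposition χ₁ χ₁-dec , isDecomposition χ₂ χ₂-dec ,
        (λ same → χ₁≁χ₂ (restrict-sameWay χ₁ χ₂ _ _ same))
        where
        isDecomposition : ∀ ψ → (∀ i j → ψ i ≡ ψ j → Comparable _⊑_ (ι i) (ι j)) →
                          IsTwoChainDecomposition _⊑_ (extend ψ (not (ψ u′)))
        isDecomposition ψ ψ-dec = extend-isDecomposition _⊑_ (λ _ → Q.refl) ψ _ ψ-dec
          (λ i e → weaken∼ (x∼others (ι i) (ι≢x i) (oppositeToU⇒≢u ψ i e)))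

      several : SeveralTwoChainDecompositions _⊑_
      several with proj₂ refines
      ... | a , b , a⊑b , a⋠b = go (view a) (view b) a⊑b a⋠b
        where
        go : ∀ {a b} → View a → View b → a ⊑ b → ¬ (a ≼ b) → SeveralTwoChainDecompositions _⊑_
        go new new _ x⋠x = ⊥-elim (x⋠x (≼-refl x))
        go new (old j) x⊑ιj x⋠ιj with ι j ≟ u
        ... | yes ιj≡u = x∼u⇒several (inj₁ (subst (x ⊑_) ιj≡u x⊑ιj))
        ... | no ιj≢u with x∼others (ι j) (ι≢x j) ιj≢u
        ...   | inj₁ x≼ιj = ⊥-elim (x⋠ιj x≼ιj)
        ...   | inj₂ ιj≼x = ⊥-elim (ι≢x j (Q.antisym (proj₁ refines ιj≼x) x⊑ιj))
        go (old i) new ιi⊑x ιi⋠x with ι i ≟ u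
        ... | yes ιi≡u = x∼u⇒several (inj₂ (subst (_⊑ x) ιi≡u ιi⊑x))
        ... | no ιi≢u with x∼others (ι i) (ι≢x i) ιi≢u
        ...   | inj₂ ιi≼x = ⊥-elim (ιi⋠x ιi≼x)
        ...   | inj₁ x≼ιi = ⊥-elim (ι≢x i (Q.antisym ιi⊑x (proj₁ refines x≼ιi)))
        go (old i) (old j) = old⊑old⇒several i j

  twoChain : TwoChainOrder _≼_
  twoChain = (χ , χ-isDecomposition , χ-unique) , Refined.several

isTwoChain-resp-≅ : ∀ {P Q} → P ≅ Q → IsTwoChain P → IsTwoChain Q
isTwoChain-resp-≅ {P} {Q} P≅Q ((χ , χ-dec , χ-unique) , maximal) = (χ∘ψ , χ∘ψ-dec , χ∘ψ-unique) , maximal′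
  where
  module P = FinPoset P
  module Q = FinPoset Q
  open _≅_ P≅Q
  φ : P.Carrier → Q.Carrier
  φ = Inverse.to bij
  ψ : Q.Carrier → P.Carrier
  ψ = Inverse.from bij

  φψ : ∀ b → φ (ψ b) ≡ b
  φψ b = Inverse.inverseˡ bij refl
  ψφ : ∀ a → ψ (φ a) ≡ a
  ψφ a = Inverse.inverseʳ bij refl

  reflect∼ : ∀ {a b} → Comparable Q._≼_ (φ a) (φ b) → Comparable P._≼_ a b
  reflect∼ = Sum.map (reflects _ _) (reflects _ _)

  pullback-isDecomposition : (R : Rel Q.Carrier 0ℓ) (ϑ : P.Carrier → Bool) →
    (∀ a b → ϑ a ≡ ϑ b → Comparable R (φ a) (φ b)) → IsTwoChainDecomposition R (λ b → ϑ (ψ b))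
  pullback-isDecomposition R ϑ ϑ-dec a b e = subst₂ (Comparable R) (φψ a) (φψ b) (ϑ-dec (ψ a) (ψ b) e)

  pullback-sameWay : ∀ {ϑ₁ ϑ₂ : P.Carrier → Bool} → SameWay (λ b → ϑ₁ (ψ b)) (λ b → ϑ₂ (ψ b)) → SameWay ϑ₁ ϑ₂
  pullback-sameWay {ϑ₁} {ϑ₂} (inj₁ h) = inj₁ λ a → subst (λ v → ϑ₂ v ≡ ϑ₁ v) (ψφ a) (h (φ a))
  pullback-sameWay {ϑ₁} {ϑ₂} (inj₂ h) = inj₂ λ a → subst (λ v → ϑ₂ v ≡ not (ϑ₁ v)) (ψφ a) (h (φ a))

  χ∘ψ : Q.Carrier → Bool
  χ∘ψ b = χ (ψ b)

  χ∘ψ-dec : IsTwoChainDecomposition Q._≼_ χ∘ψ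
  χ∘ψ-dec = pullback-isDecomposition Q._≼_ χ λ a b e → Sum.map (preserves a b) (preserves b a) (χ-dec a b e)

  χ∘ψ-unique : (ϑ : Q.Carrier → Bool) → IsTwoChainDecomposition Q._≼_ ϑ → SameWay χ∘ψ ϑ
  χ∘ψ-unique ϑ ϑ-dec with χ-unique (λ a → ϑ (φ a)) (λ a b e → reflect∼ (ϑ-dec (φ a) (φ b) e))
  ... | inj₁ h = inj₁ λ b → trans (cong ϑ (sym (φψ b))) (h (ψ b))
  ... | inj₂ h = inj₂ λ b → trans (cong ϑ (sym (φψ b))) (h (ψ b))

  maximal′ : (R : PartialOrderOn Q.Carrier) → ProperRefinement Q._≼_ (PartialOrderOn._≼_ R) →
             SeveralTwoChainDecompositions (PartialOrderOn._≼_ R)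
  maximal′ R (extends , a , b , a⊑b , a⋠b)
    with maximal (pullbackOrder φ (λ e → trans (sym (ψφ _)) (trans (cong ψ e) (ψφ _))) R)
           ((λ p → extends (preserves _ _ p)) , ψ a , ψ b ,
            subst₂ (PartialOrderOn._≼_ R) (sym (φψ a)) (sym (φψ b)) a⊑b ,
            (λ p → a⋠b (subst₂ Q._≼_ (φψ a) (φψ b) (preserves _ _ p))))
  ... | ϑ₁ , ϑ₂ , ϑ₁-dec , ϑ₂-dec , ϑ₁≁ϑ₂ =
    (λ b → ϑ₁ (ψ b)) , (λ b → ϑ₂ (ψ b)) ,
    pullback-isDecomposition _ ϑ₁ ϑ₁-dec , pullback-isDecomposition _ ϑ₂ ϑ₂-dec ,
    (λ same → ϑ₁≁ϑ₂ (pullback-sameWay same))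

-- Coxeter elements

⟨$⟩ʳ-injective : ∀ {n} (π : Permutation′ n) {x y} → π ⟨$⟩ʳ x ≡ π ⟨$⟩ʳ y → x ≡ y
⟨$⟩ʳ-injective π {x} {y} e = trans (sym (inverseˡ π)) (trans (cong (π ⟨$⟩ˡ_) e) (inverseˡ π))

s₀ : ∀ {m} → Permutation′ (suc (suc m))
s₀ = s 0F

s₀-involutive : ∀ {m} (y : Fin (suc (suc m))) → s₀ ⟨$⟩ʳ (s₀ ⟨$⟩ʳ y) ≡ y
s₀-involutive 0F = refl
s₀-involutive 1F = refl
s₀-involutive (suc (suc y)) = refl

prod-++ : ∀ {m} (xs ys : List (Fin m)) → prod (xs ++ ys) ≈ (prod xs ∘ₚ prod ys)
prod-++ [] ys x = refl
prod-++ (i ∷ xs) ys x = prod-++ xs ys (s i ⟨$⟩ʳ x)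

prod-map-suc : ∀ {m} (l : List (Fin m)) → prod (map Fin.suc l) ≈ lift₀ (prod l)
prod-map-suc [] 0F = refl
prod-map-suc [] (suc x) = refl
prod-map-suc (i ∷ l) x = trans (prod-map-suc l _)
  (trans (cong (lift₀ (prod l) ⟨$⟩ʳ_) (lift₀-transpose (inject₁ i) (suc i) x)) (lift₀-comp (s i) (prod l) x))

-- Abstract, so that `with` on a value of w does not also abstract inside the definition of remove.
abstract
  peelˡ : ∀ {m} → Permutation′ (suc (suc m)) → Permutation′ (suc m)
  peelˡ w = remove 0F (s₀ ∘ₚ w)

  peelʳ : ∀ {m} → Permutation′ (suc (suc m)) → Permutation′ (suc m)
  peelʳ w = remove 0F (w ∘ₚ s₀)

  lift₀-peelˡ : ∀ {m} (w : Permutation′ (suc (suc m))) → w ⟨$⟩ʳ 1F ≡ 0F →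
                ∀ y → lift₀ (peelˡ w) ⟨$⟩ʳ y ≡ w ⟨$⟩ʳ (s₀ ⟨$⟩ʳ y)
  lift₀-peelˡ w e y = lift₀-remove (s₀ ∘ₚ w) e y

  lift₀-peelʳ : ∀ {m} (w : Permutation′ (suc (suc m))) → w ⟨$⟩ʳ 0F ≡ 1F →
                ∀ y → lift₀ (peelʳ w) ⟨$⟩ʳ y ≡ s₀ ⟨$⟩ʳ (w ⟨$⟩ʳ y)
  lift₀-peelʳ w e y = lift₀-remove (w ∘ₚ s₀) (cong (s₀ ⟨$⟩ʳ_) e) y

-- A Coxeter element of 𝔖ₙ₊₂ begins or ends with s₀ (s₀ commutes with the factors on the side
-- without s₁), and deleting it leaves a Coxeter element of 𝔖ₙ₊₁ acting on {1,…,n+1}.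
Peelable : (n : ℕ) → Permutation′ n → Set
Peelable 0 w = ⊤
Peelable 1 w = ⊤
Peelable (suc (suc m)) w =
  (w ⟨$⟩ʳ 1F ≡ 0F × Peelable (suc m) (peelˡ w)) ⊎
  (w ⟨$⟩ʳ 0F ≡ 1F × Peelable (suc m) (peelʳ w))

peelˡ-factor : ∀ {m} (w : Permutation′ (suc (suc m))) → w ⟨$⟩ʳ 1F ≡ 0F → w ≈ (s₀ ∘ₚ lift₀ (peelˡ w))
peelˡ-factor w e x = sym (trans (lift₀-peelˡ w e (s₀ ⟨$⟩ʳ x)) (cong (w ⟨$⟩ʳ_) (s₀-involutive x)))

peelʳ-factor : ∀ {m} (w : Permutation′ (suc (suc m))) → w ⟨$⟩ʳ 0F ≡ 1F → w ≈ (lift₀ (peelʳ w) ∘ₚ s₀)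
peelʳ-factor w e x = sym (trans (cong (s₀ ⟨$⟩ʳ_) (lift₀-peelʳ w e x)) (s₀-involutive _))

factor⇒peelˡ : ∀ {m} (w : Permutation′ (suc (suc m))) (π : Permutation′ (suc m)) →
               w ≈ (s₀ ∘ₚ lift₀ π) → w ⟨$⟩ʳ 1F ≡ 0F × peelˡ w ≈ π
factor⇒peelˡ w π w≈ = e , λ j → suc-injective
  (trans (lift₀-peelˡ w e (suc j)) (trans (w≈ _) (cong (lift₀ π ⟨$⟩ʳ_) (s₀-involutive (suc j)))))
  where
  e : w ⟨$⟩ʳ 1F ≡ 0F
  e = w≈ 1F

factor⇒peelʳ : ∀ {m} (w : Permutation′ (suc (suc m))) (π : Permutation′ (suc m)) →
               w ≈ (lift₀ π ∘ₚ s₀) → w ⟨$⟩ʳ 0F ≡ 1F × peelʳ w ≈ π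
factor⇒peelʳ w π w≈ = e , λ j → suc-injective
  (trans (lift₀-peelʳ w e (suc j)) (trans (cong (s₀ ⟨$⟩ʳ_) (w≈ (suc j))) (s₀-involutive _)))
  where
  e : w ⟨$⟩ʳ 0F ≡ 1F
  e = w≈ 0F

lift₀-prod : ∀ {m} {π : Permutation′ (suc m)} (l : List (Fin m)) → π ≈ prod l → lift₀ π ≈ prod (map Fin.suc l)
lift₀-prod {π = π} l π≈ x = trans (lift₀-cong π (prod l) π≈ x) (sym (prod-map-suc l x))

map-suc-↭ : ∀ {m} {l : List (Fin m)} → l ↭ allFin m → map Fin.suc l ↭ tabulate {n = m} Fin.suc
map-suc-↭ {l = l} p = subst (map Fin.suc l ↭_) (map-tabulate (λ x → x) Fin.suc) (map⁺ Fin.suc p)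

peelable⇒coxeter : ∀ n (w : Permutation′ n) → Peelable n w → IsCoxeterElement n w
peelable⇒coxeter 0 w _ = tt
peelable⇒coxeter 1 w _ = [] , ↭-refl , λ { 0F → fin1 (w ⟨$⟩ʳ 0F) }
  where
  fin1 : (x : Fin 1) → x ≡ 0F
  fin1 0F = refl
peelable⇒coxeter (suc (suc m)) w (inj₁ (e , p)) with peelable⇒coxeter (suc m) (peelˡ w) p
... | l , l↭ , w′≈ = 0F ∷ map Fin.suc l , prep 0F (map-suc-↭ l↭) ,
  λ x → trans (peelˡ-factor w e x) (lift₀-prod l w′≈ (s₀ ⟨$⟩ʳ x))
peelable⇒coxeter (suc (suc m)) w (inj₂ (e , p)) with peelable⇒coxeter (suc m) (peelʳ w) p
... | l , l↭ , w′≈ = map Fin.suc l ++ [ 0F ] ,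
  ↭-trans (shift 0F (map Fin.suc l) [])
          (prep 0F (subst (_↭ tabulate {n = m} Fin.suc) (sym (++-identityʳ (map Fin.suc l))) (map-suc-↭ l↭))) ,
  λ x → trans (peelʳ-factor w e x)
          (trans (cong (s₀ ⟨$⟩ʳ_) (lift₀-prod l w′≈ x)) (sym (prod-++ (map Fin.suc l) [ 0F ] x)))

prod-fixes-0F-1F : ∀ {m} (l : List (Fin (suc (suc m)))) → 0F ∉ l → 1F ∉ l →
                   prod l ⟨$⟩ʳ 0F ≡ 0F × prod l ⟨$⟩ʳ 1F ≡ 1F
prod-fixes-0F-1F [] _ _ = refl , refl
prod-fixes-0F-1F (0F ∷ l) 0F∉ _ = ⊥-elim (0F∉ (here refl))
prod-fixes-0F-1F (1F ∷ l) _ 1F∉ = ⊥-elim (1F∉ (here refl))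
prod-fixes-0F-1F {suc m} (suc (suc j) ∷ l) 0F∉ 1F∉ = prod-fixes-0F-1F l (0F∉ ∘′ there) (1F∉ ∘′ there)

commutes-with-s₀ : ∀ {m} (π : Permutation′ (suc (suc m))) → π ⟨$⟩ʳ 0F ≡ 0F → π ⟨$⟩ʳ 1F ≡ 1F →
                   (s₀ ∘ₚ π) ≈ (π ∘ₚ s₀)
commutes-with-s₀ π π0 π1 0F = trans π1 (cong (s₀ ⟨$⟩ʳ_) (sym π0))
commutes-with-s₀ π π0 π1 1F = trans π0 (cong (s₀ ⟨$⟩ʳ_) (sym π1))
commutes-with-s₀ π π0 π1 (suc (suc y)) with π ⟨$⟩ʳ suc (suc y) in πy
... | 0F = case ⟨$⟩ʳ-injective π (trans π0 (sym πy)) of λ ()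
... | 1F = case ⟨$⟩ʳ-injective π (trans π1 (sym πy)) of λ ()
... | suc (suc _) = refl

one-side-commutes-with-s₀ : ∀ {m} (l₁ l₂ : List (Fin (suc m))) → 0F ∉ l₁ ++ l₂ → Unique (l₁ ++ l₂) →
  (s₀ ∘ₚ prod l₁) ≈ (prod l₁ ∘ₚ s₀) ⊎ (s₀ ∘ₚ prod l₂) ≈ (prod l₂ ∘ₚ s₀)
one-side-commutes-with-s₀ {zero} [] l₂ _ _ = inj₁ λ _ → refl
one-side-commutes-with-s₀ {zero} (0F ∷ l₁) l₂ 0F∉ _ = ⊥-elim (0F∉ (here refl))
one-side-commutes-with-s₀ {suc m} l₁ l₂ 0F∉ unique with DecMembership._∈?_ _≟_ 1F l₁
... | no 1F∉l₁ = inj₁ (uncurry (commutes-with-s₀ (prod l₁)) (prod-fixes-0F-1F l₁ (0F∉ ∘′ ∈-++⁺ˡ) 1F∉l₁))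
... | yes 1F∈l₁ = inj₂ (uncurry (commutes-with-s₀ (prod l₂))
        (prod-fixes-0F-1F l₂ (0F∉ ∘′ ∈-++⁺ʳ l₁) (λ 1F∈l₂ → disjoint l₁ unique 1F∈l₁ 1F∈l₂)))
  where
  disjoint : ∀ {a} xs → Unique (xs ++ l₂) → a ∈ xs → a ∈ l₂ → ⊥
  disjoint (_ ∷ xs) (a∉ ∷ _) (here refl) a∈l₂ = All.lookup a∉ (∈-++⁺ʳ xs a∈l₂) refl
  disjoint (_ ∷ xs) (_ ∷ unique) (there a∈xs) a∈l₂ = disjoint xs unique a∈xs a∈l₂

record SplitAt0F {m} (l : List (Fin (suc m))) : Set where
  field
    left right : List (Fin (suc m))
    rest : List (Fin m)
    split : l ≡ left ++ 0F ∷ right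
    others : left ++ right ≡ map Fin.suc rest
    rest↭ : allFin m ↭ rest

splitAt0F : ∀ {m} {l : List (Fin (suc m))} → l ↭ allFin (suc m) → SplitAt0F l
splitAt0F {m} {l} l↭ with ∈-∃++ (∈-resp-↭ (↭-sym l↭) (here refl))
... | left , right , split
  with ↭-map-inv Fin.suc (↭-sym (subst (left ++ right ↭_) (sym (map-tabulate (λ x → x) Fin.suc))
                                  (drop-mid left [] (subst (_↭ allFin (suc m)) split l↭))))
...   | rest , others , rest↭ = record
  { left = left ; right = right ; rest = rest ; split = split ; others = others ; rest↭ = rest↭ }

module CoxeterWord {m} (w : Permutation′ (suc (suc m))) (l : List (Fin (suc m)))
                   (l↭ : l ↭ allFin (suc m)) (w≈ : w ≈ prod l) where
  open SplitAt0F (splitAt0F l↭) public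

  0F∉ : 0F ∉ left ++ right
  0F∉ 0F∈ with ∈-map⁻ Fin.suc (subst (0F ∈_) others 0F∈)
  ... | _ , _ , ()

  unique : Unique (left ++ right)
  unique = subst Unique (sym others)
    (Unique.map⁺ suc-injective (PermutationSetoid.Unique-resp-↭ (setoid _) (↭⇒↭ₛ rest↭) (Unique.allFin⁺ m)))

  w-split : ∀ x → w ⟨$⟩ʳ x ≡ prod right ⟨$⟩ʳ (s₀ ⟨$⟩ʳ (prod left ⟨$⟩ʳ x))
  w-split x = trans (w≈ x) (trans (cong (λ l → prod l ⟨$⟩ʳ x) split) (prod-++ left (0F ∷ right) x))

  others-lift : ∀ x → prod right ⟨$⟩ʳ (prod left ⟨$⟩ʳ x) ≡ lift₀ (prod rest) ⟨$⟩ʳ x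
  others-lift x = trans (sym (prod-++ left right x))
    (trans (cong (λ l → prod l ⟨$⟩ʳ x) others) (prod-map-suc rest x))

coxeter⇒peeled : ∀ {m} (w : Permutation′ (suc (suc m))) → IsCoxeterElement (suc (suc m)) w →
  (w ⟨$⟩ʳ 1F ≡ 0F × IsCoxeterElement (suc m) (peelˡ w)) ⊎
  (w ⟨$⟩ʳ 0F ≡ 1F × IsCoxeterElement (suc m) (peelʳ w))
coxeter⇒peeled w (l , l↭ , w≈) with one-side-commutes-with-s₀ left right 0F∉ unique
  where open CoxeterWord w l l↭ w≈
... | inj₁ left-commutes = inj₁ (Product.map₂ (λ w′≈ → rest , ↭-sym rest↭ , w′≈) (factor⇒peelˡ w (prod rest) λ x →
  trans (w-split x) (trans (cong (prod right ⟨$⟩ʳ_) (sym (left-commutes x))) (others-lift (s₀ ⟨$⟩ʳ x)))))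
  where open CoxeterWord w l l↭ w≈
... | inj₂ right-commutes = inj₂ (Product.map₂ (λ w′≈ → rest , ↭-sym rest↭ , w′≈) (factor⇒peelʳ w (prod rest) λ x →
  trans (w-split x) (trans (right-commutes _) (cong (s₀ ⟨$⟩ʳ_) (others-lift x)))))
  where open CoxeterWord w l l↭ w≈

coxeter⇒peelable : ∀ n (w : Permutation′ n) → IsCoxeterElement n w → Peelable n w
coxeter⇒peelable 0 w _ = tt
coxeter⇒peelable 1 w _ = tt
coxeter⇒peelable (suc (suc m)) w c =
  Sum.map (Product.map₂ (coxeter⇒peelable (suc m) _)) (Product.map₂ (coxeter⇒peelable (suc m) _))
          (coxeter⇒peeled w c)

-- ℛ_w for Coxeter elements w

≼ᴿ-refl : ∀ {n} (w : Permutation′ n) a → (w ≼ᴿ a) a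
≼ᴿ-refl w a = ℕ.≤-refl , ℕ.≤-refl

twoChain-𝔖₀ : (w : Permutation′ 0) → IsTwoChain (ℛ w)
twoChain-𝔖₀ w = ((λ ()) , (λ ()) , (λ _ _ → inj₁ (λ ()))) , λ { Q (_ , () , _) }

twoChain-𝔖₁ : (w : Permutation′ 1) → IsTwoChain (ℛ w)
twoChain-𝔖₁ w = ((λ _ → false) , (λ { 0F 0F _ → inj₁ (≼ᴿ-refl w 0F) }) , unique) ,
                λ { Q (_ , 0F , 0F , _ , 0⋠0) → ⊥-elim (0⋠0 (≼ᴿ-refl w 0F)) }
  where
  unique : (χ : Fin 1 → Bool) → IsTwoChainDecomposition (w ≼ᴿ_) χ → SameWay (λ _ → false) χ
  unique χ _ with χ 0F in e
  ... | false = inj₁ λ { 0F → e }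
  ... | true = inj₂ λ { 0F → e }

s₀-suc : ∀ {m} (i : Fin (suc m)) → s₀ ⟨$⟩ʳ suc i ≡ punchIn 1F i
s₀-suc 0F = refl
s₀-suc (suc i) = refl

s₀-mono-≤ : ∀ {m} (a b : Fin (suc (suc m))) → a ≢ 1F → b ≢ 1F → a Fin.≤ b → s₀ ⟨$⟩ʳ a Fin.≤ s₀ ⟨$⟩ʳ b
s₀-mono-≤ 0F 0F _ _ _ = ℕ.≤-refl
s₀-mono-≤ 0F 1F _ b≢1 _ = ⊥-elim (b≢1 refl)
s₀-mono-≤ 0F (suc (suc b)) _ _ _ = s≤s z≤n
s₀-mono-≤ 1F b a≢1 _ _ = ⊥-elim (a≢1 refl)
s₀-mono-≤ (suc (suc a)) 1F _ b≢1 _ = ⊥-elim (b≢1 refl)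
s₀-mono-≤ (suc (suc a)) (suc (suc b)) _ _ a≤b = a≤b

s₀-cancel-≤ : ∀ {m} (a b : Fin (suc (suc m))) → a ≢ 1F → b ≢ 1F → s₀ ⟨$⟩ʳ a Fin.≤ s₀ ⟨$⟩ʳ b → a Fin.≤ b
s₀-cancel-≤ 0F 0F _ _ _ = ℕ.≤-refl
s₀-cancel-≤ 0F 1F _ b≢1 _ = ⊥-elim (b≢1 refl)
s₀-cancel-≤ 0F (suc (suc b)) _ _ _ = z≤n
s₀-cancel-≤ 1F b a≢1 _ _ = ⊥-elim (a≢1 refl)
s₀-cancel-≤ (suc (suc a)) 0F _ _ (s≤s ())
s₀-cancel-≤ (suc (suc a)) 1F _ b≢1 _ = ⊥-elim (b≢1 refl)
s₀-cancel-≤ (suc (suc a)) (suc (suc b)) _ _ a≤b = a≤b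

≤0⇒≡0F : ∀ {n} (a : Fin (suc n)) → toℕ a ≤ 0 → a ≡ 0F
≤0⇒≡0F 0F _ = refl

peelˡ-values : ∀ {m} (w : Permutation′ (suc (suc m))) → w ⟨$⟩ʳ 1F ≡ 0F →
               ∀ i → suc (peelˡ w ⟨$⟩ʳ i) ≡ w ⟨$⟩ʳ punchIn 1F i
peelˡ-values w w1≡0 i = trans (lift₀-peelˡ w w1≡0 (suc i)) (cong (w ⟨$⟩ʳ_) (s₀-suc i))

peelʳ-values : ∀ {m} (w : Permutation′ (suc (suc m))) → w ⟨$⟩ʳ 0F ≡ 1F →
               ∀ i → suc (peelʳ w ⟨$⟩ʳ i) ≡ s₀ ⟨$⟩ʳ (w ⟨$⟩ʳ suc i)
peelʳ-values w w0≡1 i = lift₀-peelʳ w w0≡1 (suc i)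

w-suc≢1F : ∀ {m} (w : Permutation′ (suc (suc m))) → w ⟨$⟩ʳ 0F ≡ 1F → ∀ i → w ⟨$⟩ʳ suc i ≢ 1F
w-suc≢1F w w0≡1 i e = case ⟨$⟩ʳ-injective w (trans e (sym w0≡1)) of λ ()

module PeeledLeft {m} (w : Permutation′ (suc (suc m))) (w1≡0 : w ⟨$⟩ʳ 1F ≡ 0F) where
  private
    w′ : Permutation′ (suc m)
    w′ = peelˡ w

    values : ∀ i → suc (w′ ⟨$⟩ʳ i) ≡ w ⟨$⟩ʳ punchIn 1F i
    values = peelˡ-values w w1≡0

    restrict : ∀ i j → (w ≼ᴿ punchIn 1F i) (punchIn 1F j) → (w′ ≼ᴿ i) j
    restrict i j (p , q) = punchIn-cancel-≤ 1F i j p , ℕ.≤-pred (subst₂ Fin._≤_ (sym (values i)) (sym (values j)) q)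

    unrestrict : ∀ i j → (w′ ≼ᴿ i) j → (w ≼ᴿ punchIn 1F i) (punchIn 1F j)
    unrestrict i j (p , q) = punchIn-mono-≤ 1F i j p , subst₂ Fin._≤_ (values i) (values j) (s≤s q)

    1≁0 : ¬ Comparable (w ≼ᴿ_) 1F 0F
    1≁0 (inj₁ (() , _))
    1≁0 (inj₂ (_ , w0≤w1)) =
      case ⟨$⟩ʳ-injective w (trans (≤0⇒≡0F _ (subst ((w ⟨$⟩ʳ 0F) Fin.≤_) w1≡0 w0≤w1)) (sym w1≡0)) of λ ()

    1∼others : ∀ z → z ≢ 1F → z ≢ 0F → Comparable (w ≼ᴿ_) 1F z
    1∼others 0F _ z≢0 = ⊥-elim (z≢0 refl)
    1∼others 1F z≢1 _ = ⊥-elim (z≢1 refl)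
    1∼others (suc (suc z)) _ _ = inj₁ (s≤s z≤n , subst (Fin._≤ (w ⟨$⟩ʳ suc (suc z))) (sym w1≡0) z≤n)

  twoChain : IsTwoChain (ℛ w′) → IsTwoChain (ℛ w)
  twoChain = AdjoinPoint.twoChain (w ≼ᴿ_) (≼ᴿ-refl w) (w′ ≼ᴿ_) 1F 0F (λ ()) restrict unrestrict 1≁0 1∼others

module PeeledRight {m} (w : Permutation′ (suc (suc m))) (w0≡1 : w ⟨$⟩ʳ 0F ≡ 1F) where
  private
    w′ : Permutation′ (suc m)
    w′ = peelʳ w

    u : Fin (suc (suc m))
    u = w ⟨$⟩ˡ 0F

    values : ∀ i → suc (w′ ⟨$⟩ʳ i) ≡ s₀ ⟨$⟩ʳ (w ⟨$⟩ʳ suc i)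
    values = peelʳ-values w w0≡1

    w-suc≢1 : ∀ i → w ⟨$⟩ʳ suc i ≢ 1F
    w-suc≢1 = w-suc≢1F w w0≡1

    restrict : ∀ i j → (w ≼ᴿ suc i) (suc j) → (w′ ≼ᴿ i) j
    restrict i j (s≤s p , q) = p ,
      ℕ.≤-pred (subst₂ Fin._≤_ (sym (values i)) (sym (values j)) (s₀-mono-≤ _ _ (w-suc≢1 i) (w-suc≢1 j) q))

    unrestrict : ∀ i j → (w′ ≼ᴿ i) j → (w ≼ᴿ suc i) (suc j)
    unrestrict i j (p , q) = s≤s p ,
      s₀-cancel-≤ _ _ (w-suc≢1 i) (w-suc≢1 j) (subst₂ Fin._≤_ (values i) (values j) (s≤s q))

    0≢u : 0F ≢ u
    0≢u 0≡u = case trans (sym w0≡1) (trans (cong (w ⟨$⟩ʳ_) 0≡u) (inverseʳ w)) of λ ()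

    0≁u : ¬ Comparable (w ≼ᴿ_) 0F u
    0≁u (inj₁ (_ , w0≤wu)) = case subst₂ Fin._≤_ w0≡1 (inverseʳ w) w0≤wu of λ ()
    0≁u (inj₂ (u≤0 , _)) = 0≢u (sym (≤0⇒≡0F u u≤0))

    0∼others : ∀ z → z ≢ 0F → z ≢ u → Comparable (w ≼ᴿ_) 0F z
    0∼others 0F z≢0 _ = ⊥-elim (z≢0 refl)
    0∼others (suc z) _ z≢u with w ⟨$⟩ʳ suc z in wz
    ... | 0F = ⊥-elim (z≢u (trans (sym (inverseˡ w)) (cong (w ⟨$⟩ˡ_) wz)))
    ... | suc v = inj₁ (z≤n , subst (Fin._≤ suc v) (sym w0≡1) (s≤s z≤n))

  twoChain : IsTwoChain (ℛ w′) → IsTwoChain (ℛ w)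
  twoChain = AdjoinPoint.twoChain (w ≼ᴿ_) (≼ᴿ-refl w) (w′ ≼ᴿ_) 0F u 0≢u restrict unrestrict 0≁u 0∼others

peelable⇒twoChain : ∀ n (w : Permutation′ n) → Peelable n w → IsTwoChain (ℛ w)
peelable⇒twoChain 0 w _ = twoChain-𝔖₀ w
peelable⇒twoChain 1 w _ = twoChain-𝔖₁ w
peelable⇒twoChain (suc (suc m)) w (inj₁ (e , p)) = PeeledLeft.twoChain w e (peelable⇒twoChain (suc m) (peelˡ w) p)
peelable⇒twoChain (suc (suc m)) w (inj₂ (e , p)) = PeeledRight.twoChain w e (peelable⇒twoChain (suc m) (peelʳ w) p)

-- Permutations w for which ℛ_w is a 2-chain

⟦_⟧ : ∀ {n} → Permutation′ n → Fin n → ℕ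
⟦ w ⟧ x = toℕ (w ⟨$⟩ʳ x)

⟦⟧-injective : ∀ {n} (w : Permutation′ n) {x y} → ⟦ w ⟧ x ≡ ⟦ w ⟧ y → x ≡ y
⟦⟧-injective w e = ⟨$⟩ʳ-injective w (toℕ-injective e)

-- Pigeonhole: otherwise w would map y and the k + 1 positions up to k injectively into {0,…,k}.
prefix-closed⇒suffix-closed : ∀ {n} (w : Permutation′ n) k → (∀ x → toℕ x ≤ k → ⟦ w ⟧ x ≤ k) →
                              ∀ y → k < toℕ y → k < ⟦ w ⟧ y
prefix-closed⇒suffix-closed {n} w k closed y k<y with ⟦ w ⟧ y ℕ.≤? k
... | no wy≰k = ℕ.≰⇒> wy≰k
... | yes wy≤k = ⊥-elim (ℕ.<-irrefl refl (injective⇒≤ f-injective))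
  where
  k<n : suc k ≤ n
  k<n = ℕ.<-trans k<y (toℕ<n y)

  p : Fin (suc (suc k)) → Fin n
  p 0F = y
  p (suc t) = Fin.inject≤ t k<n

  p≤k : ∀ t → ⟦ w ⟧ (p t) ≤ k
  p≤k 0F = wy≤k
  p≤k (suc t) = closed _ (subst (_≤ k) (sym (toℕ-inject≤ t k<n)) (ℕ.≤-pred (toℕ<n t)))

  y≢p-suc : ∀ t → y ≢ Fin.inject≤ t k<n
  y≢p-suc t y≡ = ℕ.<⇒≱ k<y (subst (_≤ k) (sym (trans (cong toℕ y≡) (toℕ-inject≤ t k<n))) (ℕ.≤-pred (toℕ<n t)))

  p-injective : ∀ {s t} → p s ≡ p t → s ≡ t
  p-injective {0F} {0F} _ = refl
  p-injective {0F} {suc t} y≡ = ⊥-elim (y≢p-suc t y≡)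
  p-injective {suc s} {0F} ≡y = ⊥-elim (y≢p-suc s (sym ≡y))
  p-injective {suc s} {suc t} e = cong suc (inject≤-injective _ _ s t e)

  f : Fin (suc (suc k)) → Fin (suc k)
  f t = fromℕ< (s≤s (p≤k t))

  f-injective : ∀ {s t} → f s ≡ f t → s ≡ t
  f-injective {s} {t} e = p-injective (⟦⟧-injective w (trans (sym (toℕ-fromℕ< _)) (trans (cong toℕ e) (toℕ-fromℕ< _))))

-- Otherwise w⁻¹ maps {0,…,k} into itself, hence also {k+1,…} into itself, but w⁻¹(w x) = x ≤ k.
crossing : ∀ {n} (w : Permutation′ n) k x → toℕ x ≤ k → k < ⟦ w ⟧ x → ∃ λ y → k < toℕ y × ⟦ w ⟧ y ≤ k
crossing w k x x≤k k<wx with any? (λ y → (k ℕ.<? toℕ y) ×-dec (⟦ w ⟧ y ℕ.≤? k))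
... | yes found = found
... | no none = ⊥-elim (ℕ.<⇒≱ (prefix-closed⇒suffix-closed (flip w) k w⁻¹-closed (w ⟨$⟩ʳ x) k<wx)
                        (subst (_≤ k) (sym (cong toℕ (inverseˡ w))) x≤k))
  where
  w-suffix-closed : ∀ y → k < toℕ y → k < ⟦ w ⟧ y
  w-suffix-closed y k<y = ℕ.≰⇒> λ wy≤k → none (y , k<y , wy≤k)
  w⁻¹-closed : ∀ t → toℕ t ≤ k → ⟦ flip w ⟧ t ≤ k
  w⁻¹-closed t t≤k = ℕ.≮⇒≥ λ k<w⁻¹t →
    ℕ.<⇒≱ (subst (k <_) (cong toℕ (inverseʳ w)) (w-suffix-closed _ k<w⁻¹t)) t≤k

Avoids321 : ∀ {n} → Permutation′ n → Set
Avoids321 w = ∀ a b c → toℕ a < toℕ b → toℕ b < toℕ c → ⟦ w ⟧ b < ⟦ w ⟧ a → ⟦ w ⟧ c < ⟦ w ⟧ b → ⊥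

Indecomposable : ∀ {n} → Permutation′ n → Set
Indecomposable {n} w = ∀ k → suc k < n → ∃ λ x → toℕ x ≤ k × k < ⟦ w ⟧ x

TightDescents : ∀ {n} → Permutation′ n → Set
TightDescents w = ∀ i j → toℕ j ≡ suc (toℕ i) → ⟦ w ⟧ j < ⟦ w ⟧ i →
  (∀ z → toℕ z < toℕ i → ⟦ w ⟧ z ≤ toℕ i) × ⟦ w ⟧ j ≤ toℕ i

inversion⇒incomparable : ∀ {n} (w : Permutation′ n) a b → toℕ a < toℕ b → ⟦ w ⟧ b < ⟦ w ⟧ a →
                         ¬ Comparable (w ≼ᴿ_) a b
inversion⇒incomparable w a b a<b wb<wa (inj₁ (_ , wa≤wb)) = ℕ.<⇒≱ wb<wa wa≤wb
inversion⇒incomparable w a b a<b wb<wa (inj₂ (b≤a , _)) = ℕ.<⇒≱ a<b b≤a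

distinct-≤⇒< : ∀ {n} {a b : Fin n} → toℕ a ≤ toℕ b → a ≢ b → toℕ a < toℕ b
distinct-≤⇒< a≤b a≢b = ℕ.≤∧≢⇒< a≤b (a≢b ∘′ toℕ-injective)

<⇒≢ : ∀ {n} {a b : Fin n} → toℕ a < toℕ b → a ≢ b
<⇒≢ a<b a≡b = ℕ.<-irrefl (cong toℕ a≡b) a<b

<-cmp-≢ : ∀ {n} (w : Permutation′ n) x y → x ≢ y → ⟦ w ⟧ x < ⟦ w ⟧ y ⊎ ⟦ w ⟧ y < ⟦ w ⟧ x
<-cmp-≢ w x y x≢y with ℕ.<-cmp (⟦ w ⟧ x) (⟦ w ⟧ y)
... | tri< wx<wy _ _ = inj₁ wx<wy
... | tri≈ _ wx≡wy _ = ⊥-elim (x≢y (⟦⟧-injective w wx≡wy))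
... | tri> _ _ wy<wx = inj₂ wy<wx

-- χ₁ xor χ₂ is constant along inversions, and indecomposability makes the inversion graph connected.
module IndecomposableUnique {n} (w : Permutation′ (suc n)) (indecomposable : Indecomposable w)
                            (χ₁ χ₂ : Fin (suc n) → Bool)
                            (χ₁-dec : IsTwoChainDecomposition (w ≼ᴿ_) χ₁)
                            (χ₂-dec : IsTwoChainDecomposition (w ≼ᴿ_) χ₂) where
  private
    δ : Fin (suc n) → Bool
    δ z = χ₁ z xor χ₂ z

    δ-inversion : ∀ a b → toℕ a < toℕ b → ⟦ w ⟧ b < ⟦ w ⟧ a → δ a ≡ δ b
    δ-inversion a b a<b wb<wa =
      trans (cong₂ _xor_ (¬-not (λ e → a≁b (χ₁-dec a b e))) (¬-not (λ e → a≁b (χ₂-dec a b e))))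
            (xor-annihilates-not (χ₁ b) (χ₂ b))
      where
      a≁b : ¬ Comparable (w ≼ᴿ_) a b
      a≁b = inversion⇒incomparable w a b a<b wb<wa

    δ-between : ∀ x y z → toℕ x < toℕ z → toℕ z ≤ toℕ y → ⟦ w ⟧ y < ⟦ w ⟧ x → δ z ≡ δ x
    δ-between x y z x<z z≤y wy<wx with ℕ.m≤n⇒m<n∨m≡n z≤y
    ... | inj₂ z≡y = trans (cong δ (toℕ-injective z≡y)) (sym (δ-inversion x y (ℕ.<-≤-trans x<z z≤y) wy<wx))
    ... | inj₁ z<y with <-cmp-≢ w z x (<⇒≢ x<z ∘′ sym)
    ...   | inj₁ wz<wx = sym (δ-inversion x z x<z wz<wx)
    ...   | inj₂ wx<wz = trans (δ-inversion z y z<y (ℕ.<-trans wy<wx wx<wz))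
                               (sym (δ-inversion x y (ℕ.<-trans x<z z<y) wy<wx))

    -- Position t + 1 lies between the ends of an inversion x ≤ t < y, found by indecomposability.
    δ-constant : ∀ t z → toℕ z ≤ t → δ z ≡ δ 0F
    δ-constant zero z z≤0 = cong δ (≤0⇒≡0F z z≤0)
    δ-constant (suc t) z z≤t+1 with ℕ.m≤n⇒m<n∨m≡n z≤t+1
    ... | inj₁ z<t+1 = δ-constant t z (ℕ.≤-pred z<t+1)
    ... | inj₂ z≡t+1 with indecomposable t (subst (_< suc n) z≡t+1 (toℕ<n z))
    ...   | x , x≤t , t<wx with crossing w t x x≤t t<wx
    ...     | y , t<y , wy≤t =
      trans (δ-between x y z (subst (toℕ x <_) (sym z≡t+1) (s≤s x≤t)) (subst (_≤ toℕ y) (sym z≡t+1) t<y)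
                       (ℕ.≤-<-trans wy≤t t<wx))
            (δ-constant t x x≤t)

  sameWay : SameWay χ₁ χ₂
  sameWay with δ 0F in δ0
  ... | false = inj₁ λ z → agree (χ₁ z) (χ₂ z) (trans (δ-constant (toℕ z) z ℕ.≤-refl) δ0)
    where
    agree : ∀ a b → a xor b ≡ false → b ≡ a
    agree false false _ = refl
    agree true true _ = refl
  ... | true = inj₂ λ z → disagree (χ₁ z) (χ₂ z) (trans (δ-constant (toℕ z) z ℕ.≤-refl) δ0)
    where
    disagree : ∀ a b → a xor b ≡ true → b ≡ not a
    disagree false true _ = refl
    disagree true false _ = refl

indecomposable⇒sameWay : ∀ {n} (w : Permutation′ n) → Indecomposable w → (χ₁ χ₂ : Fin n → Bool) →
  IsTwoChainDecomposition (w ≼ᴿ_) χ₁ → IsTwoChainDecomposition (w ≼ᴿ_) χ₂ → SameWay χ₁ χ₂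
indecomposable⇒sameWay {zero} w _ χ₁ χ₂ _ _ = inj₁ λ ()
indecomposable⇒sameWay {suc n} w ind χ₁ χ₂ χ₁-dec χ₂-dec = IndecomposableUnique.sameWay w ind χ₁ χ₂ χ₁-dec χ₂-dec

decomposition⇒avoids321 : ∀ {n} (w : Permutation′ n) {χ} → IsTwoChainDecomposition (w ≼ᴿ_) χ → Avoids321 w
decomposition⇒avoids321 w {χ} χ-dec a b c a<b b<c wb<wa wc<wb with χ a ≟ᵇ χ b | χ b ≟ᵇ χ c
... | yes χa≡χb | _ = inversion⇒incomparable w a b a<b wb<wa (χ-dec a b χa≡χb)
... | no _ | yes χb≡χc = inversion⇒incomparable w b c b<c wc<wb (χ-dec b c χb≡χc)
... | no χa≢χb | no χb≢χc = inversion⇒incomparable w a c (ℕ.<-trans a<b b<c) (ℕ.<-trans wc<wb wb<wa)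
        (χ-dec a c (trans (¬-not χa≢χb) (sym (¬-not (χb≢χc ∘′ sym)))))

-- If w maps {0,…,k} onto itself, recolouring the points above k gives another decomposition.
module Recolour {n} (w : Permutation′ n) (k : ℕ) (closed : ∀ x → toℕ x ≤ k → ⟦ w ⟧ x ≤ k)
                (χ : Fin n → Bool) (χ-dec : IsTwoChainDecomposition (w ≼ᴿ_) χ) where

  χ′ : Fin n → Bool
  χ′ z with toℕ z ℕ.≤? k
  ... | yes _ = χ z
  ... | no _ = not (χ z)

  χ′-dec : IsTwoChainDecomposition (w ≼ᴿ_) χ′
  χ′-dec a b e with toℕ a ℕ.≤? k | toℕ b ℕ.≤? k
  ... | yes _ | yes _ = χ-dec a b e
  ... | no _ | no _ = χ-dec a b (not-injective e)
  ... | yes a≤k | no b≰k = inj₁ (ℕ.≤-trans a≤k (ℕ.<⇒≤ (ℕ.≰⇒> b≰k)) ,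
    ℕ.≤-trans (closed a a≤k) (ℕ.<⇒≤ (prefix-closed⇒suffix-closed w k closed b (ℕ.≰⇒> b≰k))))
  ... | no a≰k | yes b≤k = inj₂ (ℕ.≤-trans b≤k (ℕ.<⇒≤ (ℕ.≰⇒> a≰k)) ,
    ℕ.≤-trans (closed b b≤k) (ℕ.<⇒≤ (prefix-closed⇒suffix-closed w k closed a (ℕ.≰⇒> a≰k))))

  χ′-below : ∀ z → toℕ z ≤ k → χ′ z ≡ χ z
  χ′-below z z≤k with toℕ z ℕ.≤? k
  ... | yes _ = refl
  ... | no z≰k = ⊥-elim (z≰k z≤k)

  χ′-above : ∀ z → k < toℕ z → χ′ z ≡ not (χ z)
  χ′-above z k<z with toℕ z ℕ.≤? k
  ... | yes z≤k = ⊥-elim (ℕ.<⇒≱ k<z z≤k)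
  ... | no _ = refl

  different : suc k < n → ¬ SameWay χ χ′
  different k+1<n (inj₁ same) =
    not-¬ refl (trans (sym (same top)) (χ′-above top (subst (k <_) (sym (toℕ-fromℕ< k+1<n)) ℕ.≤-refl)))
    where
    top : Fin n
    top = fromℕ< k+1<n
  different k+1<n (inj₂ opposite) =
    not-¬ refl (trans (sym (χ′-below bottom (subst (_≤ k) (sym (toℕ-fromℕ< _)) z≤n))) (opposite bottom))
    where
    bottom : Fin n
    bottom = fromℕ< (ℕ.<-trans (s≤s z≤n) k+1<n)

unique⇒indecomposable : ∀ {n} (w : Permutation′ n) → UniqueTwoChainDecomposition (w ≼ᴿ_) → Indecomposable w
unique⇒indecomposable {n} w (χ , χ-dec , χ-unique) k k+1<n
  with any? (λ x → (toℕ x ℕ.≤? k) ×-dec (k ℕ.<? ⟦ w ⟧ x))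
... | yes found = found
... | no none = ⊥-elim (different k+1<n (χ-unique χ′ χ′-dec))
  where open Recolour w k (λ x x≤k → ℕ.≮⇒≥ λ k<wx → none (x , x≤k , k<wx)) χ χ-dec

module _ {n} (i j : Fin n) where
  private
    τ : Permutation′ n
    τ = transpose i j

  transpose-cases : ∀ x → (x ≡ i × τ ⟨$⟩ʳ x ≡ j) ⊎ (x ≡ j × τ ⟨$⟩ʳ x ≡ i) ⊎ (x ≢ i × x ≢ j × τ ⟨$⟩ʳ x ≡ x)
  transpose-cases x with x ≟ i
  ... | yes x≡i = inj₁ (x≡i , refl)
  ... | no x≢i with x ≟ j
  ...   | yes x≡j = inj₂ (inj₁ (x≡j , refl))
  ...   | no x≢j = inj₂ (inj₂ (x≢i , x≢j , refl))

  transpose-j : τ ⟨$⟩ʳ j ≡ i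
  transpose-j with transpose-cases j
  ... | inj₁ (j≡i , τj≡j) = trans τj≡j j≡i
  ... | inj₂ (inj₁ (_ , τj≡i)) = τj≡i
  ... | inj₂ (inj₂ (_ , j≢j , _)) = ⊥-elim (j≢j refl)

  transpose-i : τ ⟨$⟩ʳ i ≡ j
  transpose-i with transpose-cases i
  ... | inj₁ (_ , τi≡j) = τi≡j
  ... | inj₂ (inj₁ (i≡j , τi≡i)) = trans τi≡i i≡j
  ... | inj₂ (inj₂ (i≢i , _)) = ⊥-elim (i≢i refl)

  transpose-involutive : ∀ x → τ ⟨$⟩ʳ (τ ⟨$⟩ʳ x) ≡ x
  transpose-involutive x with transpose-cases x
  ... | inj₁ (x≡i , τx≡j) = trans (cong (τ ⟨$⟩ʳ_) τx≡j) (trans transpose-j (sym x≡i))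
  ... | inj₂ (inj₁ (x≡j , τx≡i)) = trans (cong (τ ⟨$⟩ʳ_) τx≡i) (trans transpose-i (sym x≡j))
  ... | inj₂ (inj₂ (_ , _ , τx≡x)) = trans (cong (τ ⟨$⟩ʳ_) τx≡x) τx≡x

-- At a descent i, i+1 of w, ordering the two positions the other way round gives a proper refinement
-- of ℛ w isomorphic to ℛ (τ ∘ w), τ = (i i+1).  If the descent is not tight, τ ∘ w is still
-- indecomposable, so the refinement has a unique decomposition, against maximality.
module DescentRefinement {n} (w : Permutation′ n) (twoChain : IsTwoChain (ℛ w)) (i j : Fin n)
                         (j≡i+1 : toℕ j ≡ suc (toℕ i)) (wj<wi : ⟦ w ⟧ j < ⟦ w ⟧ i)
                         (loose : (∃ λ z → toℕ z < toℕ i × toℕ i < ⟦ w ⟧ z) ⊎ (toℕ i < ⟦ w ⟧ j)) where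
  private
    τ : Permutation′ n
    τ = transpose i j

    g : Permutation′ n
    g = τ ∘ₚ w

    ττ : ∀ x → τ ⟨$⟩ʳ (τ ⟨$⟩ʳ x) ≡ x
    ττ = transpose-involutive i j

    i<j : toℕ i < toℕ j
    i<j = ℕ.≤-reflexive (sym j≡i+1)

    τ-mono : ∀ a b → toℕ a ≤ toℕ b → ⟦ w ⟧ a ≤ ⟦ w ⟧ b → τ ⟨$⟩ʳ a Fin.≤ τ ⟨$⟩ʳ b
    τ-mono a b a≤b wa≤wb with transpose-cases i j a | transpose-cases i j b
    ... | inj₁ (refl , τa) | inj₁ (refl , τb) = ℕ.≤-reflexive (cong toℕ (trans τa (sym τb)))
    ... | inj₁ (refl , _) | inj₂ (inj₁ (refl , _)) = ⊥-elim (ℕ.<⇒≱ wj<wi wa≤wb)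
    ... | inj₁ (refl , τa) | inj₂ (inj₂ (b≢i , _ , τb)) = subst₂ Fin._≤_ (sym τa) (sym τb)
          (subst (_≤ toℕ b) (sym j≡i+1) (ℕ.≤∧≢⇒< a≤b (λ e → b≢i (toℕ-injective (sym e)))))
    ... | inj₂ (inj₁ (refl , τa)) | inj₁ (refl , τb) = subst₂ Fin._≤_ (sym τa) (sym τb) (ℕ.<⇒≤ i<j)
    ... | inj₂ (inj₁ (refl , τa)) | inj₂ (inj₁ (refl , τb)) = ℕ.≤-reflexive (cong toℕ (trans τa (sym τb)))
    ... | inj₂ (inj₁ (refl , τa)) | inj₂ (inj₂ (_ , _ , τb)) = subst₂ Fin._≤_ (sym τa) (sym τb) (ℕ.<⇒≤ (ℕ.<-≤-trans i<j a≤b))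
    ... | inj₂ (inj₂ (_ , _ , τa)) | inj₁ (refl , τb) = subst₂ Fin._≤_ (sym τa) (sym τb) (ℕ.<⇒≤ (ℕ.≤-<-trans a≤b i<j))
    ... | inj₂ (inj₂ (_ , a≢j , τa)) | inj₂ (inj₁ (refl , τb)) = subst₂ Fin._≤_ (sym τa) (sym τb)
          (ℕ.≤-pred (subst (toℕ a <_) j≡i+1 (ℕ.≤∧≢⇒< a≤b (λ e → a≢j (toℕ-injective e)))))
    ... | inj₂ (inj₂ (_ , _ , τa)) | inj₂ (inj₂ (_ , _ , τb)) = subst₂ Fin._≤_ (sym τa) (sym τb) a≤b

    Q : PartialOrderOn (Fin n)
    Q = record
      { _≼_ = λ a b → (τ ⟨$⟩ʳ a Fin.≤ τ ⟨$⟩ʳ b) × (⟦ w ⟧ a ≤ ⟦ w ⟧ b)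
      ; isPartialOrder = record
        { isPreorder = record
          { isEquivalence = isEquivalence
          ; reflexive = λ { refl → ℕ.≤-refl , ℕ.≤-refl }
          ; trans = λ { (p , q) (p′ , q′) → ℕ.≤-trans p p′ , ℕ.≤-trans q q′ } }
        ; antisym = λ { (p , _) (p′ , _) →
            trans (sym (ττ _)) (trans (cong (τ ⟨$⟩ʳ_) (toℕ-injective (ℕ.≤-antisym p p′))) (ττ _)) } }
      ; _≼?_ = λ a b → (τ ⟨$⟩ʳ a ≤? τ ⟨$⟩ʳ b) ×-dec (⟦ w ⟧ a ℕ.≤? ⟦ w ⟧ b) }

    Q-refines : ProperRefinement (w ≼ᴿ_) (PartialOrderOn._≼_ Q)
    Q-refines = (λ { {a} {b} (a≤b , wa≤wb) → τ-mono a b a≤b wa≤wb , wa≤wb }) , j , i ,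
                (subst₂ Fin._≤_ (sym (transpose-j i j)) (sym (transpose-i i j)) (ℕ.<⇒≤ i<j) , ℕ.<⇒≤ wj<wi) ,
                (λ (j≤i , _) → ℕ.<⇒≱ i<j j≤i)

    g-indecomposable-at-i : (∃ λ z → toℕ z < toℕ i × toℕ i < ⟦ w ⟧ z) ⊎ (toℕ i < ⟦ w ⟧ j) →
                            ∃ λ x → toℕ x ≤ toℕ i × toℕ i < ⟦ g ⟧ x
    g-indecomposable-at-i (inj₁ (z , z<i , i<wz)) = z , ℕ.<⇒≤ z<i , subst (λ v → toℕ i < ⟦ w ⟧ v) (sym τz≡z) i<wz
      where
      τz≡z : τ ⟨$⟩ʳ z ≡ z
      τz≡z with transpose-cases i j z
      ... | inj₁ (z≡i , _) = ⊥-elim (ℕ.<-irrefl (cong toℕ z≡i) z<i)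
      ... | inj₂ (inj₁ (z≡j , _)) = ⊥-elim (ℕ.<-irrefl (cong toℕ z≡j) (ℕ.<-trans z<i i<j))
      ... | inj₂ (inj₂ (_ , _ , τz≡z)) = τz≡z
    g-indecomposable-at-i (inj₂ i<wj) = i , ℕ.≤-refl , subst (λ v → toℕ i < ⟦ w ⟧ v) (sym (transpose-i i j)) i<wj

    g-indecomposable : Indecomposable g
    g-indecomposable c c+1<n with c ℕ.≟ toℕ i
    ... | yes refl = g-indecomposable-at-i loose
    ... | no c≢i with unique⇒indecomposable w (proj₁ twoChain) c c+1<n
    ...   | x , x≤c , c<wx = τ ⟨$⟩ʳ x , τx≤c , subst (λ v → c < ⟦ w ⟧ v) (sym (ττ x)) c<wx
      where
      τx≤c : toℕ (τ ⟨$⟩ʳ x) ≤ c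
      τx≤c with transpose-cases i j x
      ... | inj₁ (refl , τx) = subst (λ v → toℕ v ≤ c) (sym τx) (subst (_≤ c) (sym j≡i+1) (ℕ.≤∧≢⇒< x≤c (c≢i ∘′ sym)))
      ... | inj₂ (inj₁ (refl , τx)) = subst (λ v → toℕ v ≤ c) (sym τx) (ℕ.<⇒≤ (ℕ.<-≤-trans i<j x≤c))
      ... | inj₂ (inj₂ (_ , _ , τx)) = subst (λ v → toℕ v ≤ c) (sym τx) x≤c

    Q⇒ℛg : ∀ {a b} → Comparable (PartialOrderOn._≼_ Q) (τ ⟨$⟩ʳ a) (τ ⟨$⟩ʳ b) → Comparable (g ≼ᴿ_) a b
    Q⇒ℛg {a} {b} (inj₁ (p , q)) = inj₁ (subst₂ Fin._≤_ (ττ a) (ττ b) p , q)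
    Q⇒ℛg {a} {b} (inj₂ (p , q)) = inj₂ (subst₂ Fin._≤_ (ττ b) (ττ a) p , q)

  contradiction : ⊥
  contradiction with proj₂ twoChain Q Q-refines
  ... | χ₁ , χ₂ , χ₁-dec , χ₂-dec , χ₁≁χ₂ =
    χ₁≁χ₂ (back (indecomposable⇒sameWay g g-indecomposable (χ₁ ∘′ (τ ⟨$⟩ʳ_)) (χ₂ ∘′ (τ ⟨$⟩ʳ_))
                   (λ a b e → Q⇒ℛg (χ₁-dec _ _ e)) (λ a b e → Q⇒ℛg (χ₂-dec _ _ e))))
    where
    back : SameWay (χ₁ ∘′ (τ ⟨$⟩ʳ_)) (χ₂ ∘′ (τ ⟨$⟩ʳ_)) → SameWay χ₁ χ₂
    back (inj₁ h) = inj₁ λ y → subst (λ v → χ₂ v ≡ χ₁ v) (ττ y) (h (τ ⟨$⟩ʳ y))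
    back (inj₂ h) = inj₂ λ y → subst (λ v → χ₂ v ≡ not (χ₁ v)) (ττ y) (h (τ ⟨$⟩ʳ y))

twoChain⇒tightDescents : ∀ {n} (w : Permutation′ n) → IsTwoChain (ℛ w) → TightDescents w
twoChain⇒tightDescents w twoChain i j j≡i+1 wj<wi
  with any? (λ z → (toℕ z ℕ.<? toℕ i) ×-dec (toℕ i ℕ.<? ⟦ w ⟧ z)) | ⟦ w ⟧ j ℕ.≤? toℕ i
... | yes found | _ = ⊥-elim (DescentRefinement.contradiction w twoChain i j j≡i+1 wj<wi (inj₁ found))
... | no _ | no wj≰i = ⊥-elim (DescentRefinement.contradiction w twoChain i j j≡i+1 wj<wi (inj₂ (ℕ.≰⇒> wj≰i)))
... | no none | yes wj≤i = (λ z z<i → ℕ.≮⇒≥ λ i<wz → none (z , z<i , i<wz)) , wj≤i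

record IsCoxeterShaped {n} (w : Permutation′ n) : Set where
  field
    avoids321 : Avoids321 w
    indecomposable : Indecomposable w
    tightDescents : TightDescents w

twoChain⇒coxeterShaped : ∀ {n} (w : Permutation′ n) → IsTwoChain (ℛ w) → IsCoxeterShaped w
twoChain⇒coxeterShaped w twoChain = record
  { avoids321 = decomposition⇒avoids321 w (proj₁ (proj₂ (proj₁ twoChain)))
  ; indecomposable = unique⇒indecomposable w (proj₁ twoChain)
  ; tightDescents = twoChain⇒tightDescents w twoChain }

-- An ascent w(0) < w(1) with w(0) ≥ 2 propagates to w(x) ≥ x + 2 for every x, which fails at w⁻¹(0).
module _ {m} (w : Permutation′ (suc (suc m))) (tight : TightDescents w)
         (2≤w0 : 2 ≤ ⟦ w ⟧ 0F) (w0<w1 : ⟦ w ⟧ 0F < ⟦ w ⟧ 1F) where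
  private
    position : ∀ t → t < suc (suc m) → ∃ λ (x : Fin (suc (suc m))) → toℕ x ≡ t
    position t t<n = fromℕ< t<n , toℕ-fromℕ< t<n

    grows : ∀ t x → toℕ x ≤ t → 2 + toℕ x ≤ ⟦ w ⟧ x
    grows zero x x≤0 = subst (λ v → 2 + toℕ v ≤ ⟦ w ⟧ v) (sym (≤0⇒≡0F x x≤0)) 2≤w0
    grows (suc t) x x≤t+1 with ℕ.m≤n⇒m<n∨m≡n x≤t+1
    ... | inj₁ x<t+1 = grows t x (ℕ.≤-pred x<t+1)
    ... | inj₂ x≡t+1 with position t (ℕ.<-trans (ℕ.n<1+n t) (subst (_< suc (suc m)) x≡t+1 (toℕ<n x)))
    ...   | x′ , x′≡t with <-cmp-≢ w x′ x (λ x′≡x → ℕ.1+n≢n (trans (sym x≡t+1) (trans (cong toℕ (sym x′≡x)) x′≡t)))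
    ...     | inj₁ wx′<wx = subst (λ v → 2 + v ≤ ⟦ w ⟧ x) (sym x≡t+1)
                              (ℕ.<-≤-trans (s≤s (subst (λ v → 2 + v ≤ ⟦ w ⟧ x′) x′≡t (grows t x′ (ℕ.≤-reflexive x′≡t)))) wx′<wx)
    ...     | inj₂ wx<wx′ with tight x′ x (trans x≡t+1 (cong suc (sym x′≡t))) wx<wx′
    ...       | below , _ with t
    ...         | zero = ⊥-elim (ℕ.<-asym w0<w1
                        (subst₂ (λ a b → ⟦ w ⟧ a < ⟦ w ⟧ b) (toℕ-injective x≡t+1) (toℕ-injective x′≡t) wx<wx′))
    ...         | suc t′ with position t′ (ℕ.<-trans (ℕ.n<1+n t′) (subst (_< suc (suc m)) x′≡t (toℕ<n x′)))
    ...           | z , z≡t′ = ⊥-elim (ℕ.<⇒≱ (subst (λ v → 2 + v ≤ ⟦ w ⟧ z) z≡t′ (grows t′ z (ℕ.≤-reflexive z≡t′)))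
                                              (subst (⟦ w ⟧ z ≤_) x′≡t (below z (subst₂ _<_ (sym z≡t′) (sym x′≡t) (ℕ.n<1+n t′)))))

  no-large-initial-ascent : ⊥
  no-large-initial-ascent = ℕ.<⇒≱ (subst (2 + toℕ p ≤_) (cong toℕ (inverseʳ w)) (grows (toℕ p) p ℕ.≤-refl)) z≤n
    where
    p : Fin (suc (suc m))
    p = w ⟨$⟩ˡ 0F

-- If w(2) ≥ 2, then w(0) > w(2) > w(p) = 1 with p = w⁻¹(1) ≥ 3 would be a 321 pattern.
descent-0-2 : ∀ {m} (w : Permutation′ (suc (suc (suc m)))) → Avoids321 w → w ⟨$⟩ʳ 1F ≡ 0F →
              ⟦ w ⟧ 2F < ⟦ w ⟧ 0F → ⟦ w ⟧ 2F ≤ 1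
descent-0-2 {m} w avoids321 w1≡0 w2<w0 with ⟦ w ⟧ 2F ℕ.≤? 1
... | yes w2≤1 = w2≤1
... | no w2≰1 = ⊥-elim (avoids321 0F 2F p (s≤s z≤n) 2<p w2<w0 wp<w2)
  where
  p : Fin (suc (suc (suc m)))
  p = w ⟨$⟩ˡ 1F
  wp<w2 : ⟦ w ⟧ p < ⟦ w ⟧ 2F
  wp<w2 = subst (_< ⟦ w ⟧ 2F) (sym (cong toℕ (inverseʳ w))) (ℕ.≰⇒> w2≰1)
  2<p : 2 < toℕ p
  2<p with p in p≡
  ... | 0F = ⊥-elim (ℕ.<-asym w2<w0 (subst (_< ⟦ w ⟧ 2F) (cong (toℕ ∘′ (w ⟨$⟩ʳ_)) p≡) wp<w2))
  ... | 1F = case trans (sym (trans (cong (w ⟨$⟩ʳ_) (sym p≡)) (inverseʳ w))) w1≡0 of λ ()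
  ... | 2F = ⊥-elim (ℕ.<-irrefl (cong (toℕ ∘′ (w ⟨$⟩ʳ_)) p≡) wp<w2)
  ... | suc (suc (suc _)) = s≤s (s≤s (s≤s z≤n))

module PeelˡShaped {m} (w : Permutation′ (suc (suc m))) (shaped : IsCoxeterShaped w) (w1≡0 : w ⟨$⟩ʳ 1F ≡ 0F) where
  open IsCoxeterShaped shaped
  private
    w′ : Permutation′ (suc m)
    w′ = peelˡ w

    ι : Fin (suc m) → Fin (suc (suc m))
    ι = punchIn 1F

    values : ∀ i → ⟦ w′ ⟧ i ≡ pred (⟦ w ⟧ (ι i))
    values i = cong (pred ∘′ toℕ) (peelˡ-values w w1≡0 i)

    ι-mono-< : ∀ a b → toℕ a < toℕ b → toℕ (ι a) < toℕ (ι b)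
    ι-mono-< 0F (suc b) _ = s≤s z≤n
    ι-mono-< (suc a) (suc b) a<b = s≤s a<b

    ι-≤-suc : ∀ a → toℕ (ι a) ≤ suc (toℕ a)
    ι-≤-suc 0F = z≤n
    ι-≤-suc (suc a) = ℕ.≤-refl

    lift-< : ∀ a b → ⟦ w′ ⟧ a < ⟦ w′ ⟧ b → ⟦ w ⟧ (ι a) < ⟦ w ⟧ (ι b)
    lift-< a b p = ℕ.pred-cancel-< (subst₂ _<_ (values a) (values b) p)

    avoids321′ : Avoids321 w′
    avoids321′ a b c a<b b<c wb<wa wc<wb =
      avoids321 (ι a) (ι b) (ι c) (ι-mono-< a b a<b) (ι-mono-< b c b<c) (lift-< b a wb<wa) (lift-< c b wc<wb)

    indecomposable′ : Indecomposable w′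
    indecomposable′ k k+1<m+1 with indecomposable (suc k) (s≤s k+1<m+1)
    ... | 0F , _ , k+1<w0 = 0F , z≤n , subst (k <_) (sym (values 0F)) (ℕ.pred-mono-≤ k+1<w0)
    ... | 1F , _ , k+1<w1 = ⊥-elim (ℕ.<⇒≱ k+1<w1 (subst (λ v → toℕ v ≤ suc k) (sym w1≡0) z≤n))
    ... | suc (suc y) , s≤s y≤k , k+1<wy = suc y , y≤k , subst (k <_) (sym (values (suc y))) (ℕ.pred-mono-≤ k+1<wy)


    tightDescents′ : TightDescents w′
    tightDescents′ 0F 1F refl w1<w0 =
      (λ _ ()) , subst (_≤ 0) (sym (values 1F)) (ℕ.pred-mono-≤ (descent-0-2 w avoids321 w1≡0 (lift-< 1F 0F w1<w0)))
    tightDescents′ (suc i) (suc j) j≡i+1 wj<wi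
      with tightDescents (ι (suc i)) (ι (suc j)) (cong suc j≡i+1) (lift-< (suc j) (suc i) wj<wi)
    ... | below , wj≤i =
      (λ z z<i → subst (_≤ toℕ (suc i)) (sym (values z)) (ℕ.pred-mono-≤ (below (ι z) (ℕ.≤-<-trans (ι-≤-suc z) (s≤s z<i))))) ,
                         subst (_≤ toℕ (suc i)) (sym (values (suc j))) (ℕ.pred-mono-≤ wj≤i)

  shaped′ : IsCoxeterShaped w′
  shaped′ = record { avoids321 = avoids321′ ; indecomposable = indecomposable′ ; tightDescents = tightDescents′ }

module PeelʳShaped {m} (w : Permutation′ (suc (suc m))) (shaped : IsCoxeterShaped w) (w0≡1 : w ⟨$⟩ʳ 0F ≡ 1F) where
  open IsCoxeterShaped shaped
  private
    w′ : Permutation′ (suc m)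
    w′ = peelʳ w

    s₀-pred : ∀ (v : Fin (suc (suc m))) (r : Fin (suc m)) → v ≢ 1F → suc r ≡ s₀ ⟨$⟩ʳ v → toℕ r ≡ pred (toℕ v)
    s₀-pred 0F r _ e = cong toℕ (suc-injective e)
    s₀-pred 1F r v≢1 _ = ⊥-elim (v≢1 refl)
    s₀-pred (suc (suc v)) r _ e = cong toℕ (suc-injective e)

    values : ∀ i → ⟦ w′ ⟧ i ≡ pred (⟦ w ⟧ (suc i))
    values i = s₀-pred (w ⟨$⟩ʳ suc i) (w′ ⟨$⟩ʳ i) (w-suc≢1F w w0≡1 i) (peelʳ-values w w0≡1 i)

    lift-< : ∀ a b → ⟦ w′ ⟧ a < ⟦ w′ ⟧ b → ⟦ w ⟧ (suc a) < ⟦ w ⟧ (suc b)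
    lift-< a b p = ℕ.pred-cancel-< (subst₂ _<_ (values a) (values b) p)

    avoids321′ : Avoids321 w′
    avoids321′ a b c a<b b<c wb<wa wc<wb =
      avoids321 (suc a) (suc b) (suc c) (s≤s a<b) (s≤s b<c) (lift-< b a wb<wa) (lift-< c b wc<wb)

    indecomposable′ : Indecomposable w′
    indecomposable′ k k+1<m+1 with indecomposable (suc k) (s≤s k+1<m+1)
    ... | 0F , _ , k+1<w0 = ⊥-elim (ℕ.<⇒≱ k+1<w0 (subst (λ v → toℕ v ≤ suc k) (sym w0≡1) (s≤s z≤n)))
    ... | suc y , s≤s y≤k , k+1<wy = y , y≤k , subst (k <_) (sym (values y)) (ℕ.pred-mono-≤ k+1<wy)

    tightDescents′ : TightDescents w′
    tightDescents′ i j j≡i+1 wj<wi with tightDescents (suc i) (suc j) (cong suc j≡i+1) (lift-< j i wj<wi)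
    ... | below , wj≤i = (λ z z<i → subst (_≤ toℕ i) (sym (values z)) (ℕ.pred-mono-≤ (below (suc z) (s≤s z<i)))) ,
                         subst (_≤ toℕ i) (sym (values j)) (ℕ.pred-mono-≤ wj≤i)

  shaped′ : IsCoxeterShaped w′
  shaped′ = record { avoids321 = avoids321′ ; indecomposable = indecomposable′ ; tightDescents = tightDescents′ }

indecomposable⇒0<w0 : ∀ {m} (w : Permutation′ (suc (suc m))) → Indecomposable w → 0 < ⟦ w ⟧ 0F
indecomposable⇒0<w0 w indecomposable with indecomposable 0 (s≤s (s≤s z≤n))
... | x , x≤0 , 0<wx = subst (λ y → 0 < ⟦ w ⟧ y) (≤0⇒≡0F x x≤0) 0<wx

coxeterShaped⇒peeled : ∀ {m} (w : Permutation′ (suc (suc m))) → IsCoxeterShaped w →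
  (w ⟨$⟩ʳ 1F ≡ 0F × IsCoxeterShaped (peelˡ w)) ⊎ (w ⟨$⟩ʳ 0F ≡ 1F × IsCoxeterShaped (peelʳ w))
coxeterShaped⇒peeled w shaped with w ⟨$⟩ʳ 0F in w0
... | 0F = ⊥-elim (ℕ.<-irrefl (sym (cong toℕ w0)) (indecomposable⇒0<w0 w indecomposable))
  where open IsCoxeterShaped shaped
... | 1F = inj₂ (refl , PeelʳShaped.shaped′ w shaped w0)
... | suc (suc v) with <-cmp-≢ w 1F 0F (λ ())
...   | inj₁ w1<w0 = inj₁ (w1≡0 , PeelˡShaped.shaped′ w shaped w1≡0)
  where
  w1≡0 : w ⟨$⟩ʳ 1F ≡ 0F
  w1≡0 = ≤0⇒≡0F _ (proj₂ (IsCoxeterShaped.tightDescents shaped 0F 1F refl w1<w0))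
...   | inj₂ w0<w1 = ⊥-elim (no-large-initial-ascent w (IsCoxeterShaped.tightDescents shaped)
                               (subst (λ y → 2 ≤ toℕ y) (sym w0) (s≤s (s≤s z≤n))) w0<w1)

coxeterShaped⇒peelable : ∀ n (w : Permutation′ n) → IsCoxeterShaped w → Peelable n w
coxeterShaped⇒peelable 0 w _ = tt
coxeterShaped⇒peelable 1 w _ = tt
coxeterShaped⇒peelable (suc (suc m)) w shaped =
  Sum.map (Product.map₂ (coxeterShaped⇒peelable (suc m) _)) (Product.map₂ (coxeterShaped⇒peelable (suc m) _))
          (coxeterShaped⇒peeled w shaped)

-- Isomorphisms between the posets ℛ_w

ℛ-comparable? : ∀ {n} (u : Permutation′ n) a b → Dec (Comparable (u ≼ᴿ_) a b)
ℛ-comparable? u a b = FinPoset._≼?_ (ℛ u) a b ⊎-dec FinPoset._≼?_ (ℛ u) b a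

incomparable⇒inversion : ∀ {n} (u : Permutation′ n) a b → toℕ a ≤ toℕ b → ¬ Comparable (u ≼ᴿ_) a b → ⟦ u ⟧ b < ⟦ u ⟧ a
incomparable⇒inversion u a b a≤b a≁b = ℕ.≰⇒> λ ua≤ub → a≁b (inj₁ (a≤b , ua≤ub))

module Tops {n} (u : Permutation′ n) (avoids321 : Avoids321 u) where

  IsTop : Fin n → Set
  IsTop x = ∃ λ y → toℕ x < toℕ y × ⟦ u ⟧ y < ⟦ u ⟧ x

  top? : ∀ x → Dec (IsTop x)
  top? x = any? λ y → (toℕ x ℕ.<? toℕ y) ×-dec (⟦ u ⟧ y ℕ.<? ⟦ u ⟧ x)

  top : Fin n → Bool
  top x = does (top? x)

  inversion-tops : ∀ a b → toℕ a < toℕ b → ⟦ u ⟧ b < ⟦ u ⟧ a → top a ≡ true × top b ≡ false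
  inversion-tops a b a<b ub<ua = dec-true (top? a) (b , a<b , ub<ua) ,
    dec-false (top? b) λ (c , b<c , uc<ub) → avoids321 a b c a<b b<c ub<ua uc<ub

  incomparable-tops : ∀ a b → toℕ a < toℕ b → ¬ Comparable (u ≼ᴿ_) a b → top a ≡ true × top b ≡ false
  incomparable-tops a b a<b a≁b = inversion-tops a b a<b (incomparable⇒inversion u a b (ℕ.<⇒≤ a<b) a≁b)

  top-isDecomposition : IsTwoChainDecomposition (u ≼ᴿ_) top
  top-isDecomposition a b same with ℛ-comparable? u a b
  ... | yes a∼b = a∼b
  ... | no a≁b with ℕ.<-cmp (toℕ a) (toℕ b)
  ...   | tri< a<b _ _ = ⊥-elim (case incomparable-tops a b a<b a≁b of λ (ta , tb) →
                           not-¬ refl (trans (sym ta) (trans same tb)))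
  ...   | tri≈ _ a≡b _ = ⊥-elim (a≁b (inj₁ (ℕ.≤-reflexive a≡b , ℕ.≤-reflexive (cong ⟦ u ⟧ (toℕ-injective a≡b)))))
  ...   | tri> _ _ b<a = ⊥-elim (case incomparable-tops b a b<a (a≁b ∘′ swap) of λ (tb , ta) →
                           not-¬ refl (trans (sym tb) (trans (sym same) ta)))

StrictlyIncreasing : ∀ {n} → Permutation′ n → Set
StrictlyIncreasing π = ∀ a b → toℕ a < toℕ b → ⟦ π ⟧ a < ⟦ π ⟧ b

increasing⇒≥ : ∀ {n} (π : Permutation′ n) → StrictlyIncreasing π → ∀ t x → toℕ x ≡ t → t ≤ ⟦ π ⟧ x
increasing⇒≥ π increasing zero x _ = z≤n
increasing⇒≥ {n} π increasing (suc t) x x≡t+1 =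
  ℕ.≤-<-trans (increasing⇒≥ π increasing t x′ x′≡t) (increasing x′ x (subst₂ _<_ (sym x′≡t) (sym x≡t+1) (ℕ.n<1+n t)))
  where
  t<n : t < n
  t<n = ℕ.<-trans (ℕ.n<1+n t) (subst (_< n) x≡t+1 (toℕ<n x))
  x′ : Fin n
  x′ = fromℕ< t<n
  x′≡t : toℕ x′ ≡ t
  x′≡t = toℕ-fromℕ< t<n

increasing-flip : ∀ {n} (π : Permutation′ n) → StrictlyIncreasing π → StrictlyIncreasing (flip π)
increasing-flip π increasing a b a<b with ℕ.<-cmp (⟦ flip π ⟧ a) (⟦ flip π ⟧ b)
... | tri< lt _ _ = lt
... | tri≈ _ eq _ = ⊥-elim (ℕ.<-irrefl (cong toℕ (⟨$⟩ʳ-injective (flip π) (toℕ-injective eq))) a<b)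
... | tri> _ _ gt = ⊥-elim (ℕ.<-asym a<b (subst₂ _<_ (cong toℕ (inverseʳ π)) (cong toℕ (inverseʳ π)) (increasing _ _ gt)))

increasing⇒≈id : ∀ {n} (π : Permutation′ n) → StrictlyIncreasing π → π ≈ id
increasing⇒≈id π increasing x = toℕ-injective (ℕ.≤-antisym
  (subst (⟦ π ⟧ x ≤_) (cong toℕ (inverseˡ π)) (increasing⇒≥ (flip π) (increasing-flip π increasing) _ (π ⟨$⟩ʳ x) refl))
  (increasing⇒≥ π increasing _ x refl))

-- top_v and top_w ∘ φ both decompose ℛ v, so they agree or are opposite.  If they agree, φ is
-- increasing, hence φ = id and then w ∘ v⁻¹ is increasing; if they are opposite, w ∘ φ is
-- increasing and then v ∘ w is.
module Rigidity {n} (v w : Permutation′ n) (v-avoids321 : Avoids321 v) (w-avoids321 : Avoids321 w)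
                (v-unique : UniqueTwoChainDecomposition (v ≼ᴿ_)) (v≅w : ℛ v ≅ ℛ w) where
  open _≅_ v≅w
  private
    module V = Tops v v-avoids321
    module W = Tops w w-avoids321
    φ : Fin n → Fin n
    φ = bij ⟨$⟩ʳ_

    φ-incomparable : ∀ {a b} → ¬ Comparable (v ≼ᴿ_) a b → ¬ Comparable (w ≼ᴿ_) (φ a) (φ b)
    φ-incomparable a≁b = a≁b ∘′ Sum.map (reflects _ _) (reflects _ _)

    φ-comparable : ∀ {a b} → Comparable (v ≼ᴿ_) a b → Comparable (w ≼ᴿ_) (φ a) (φ b)
    φ-comparable = Sum.map (preserves _ _) (preserves _ _)

    v-inversion-incomparable : ∀ {a b} → toℕ a < toℕ b → ¬ (⟦ v ⟧ a ≤ ⟦ v ⟧ b) → ¬ Comparable (v ≼ᴿ_) a b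
    v-inversion-incomparable a<b va≰vb = inversion⇒incomparable v _ _ a<b (ℕ.≰⇒> va≰vb)

    φ-increasing : (∀ x → W.top (φ x) ≡ V.top x) → StrictlyIncreasing bij
    φ-increasing agree a b a<b with ⟦ v ⟧ a ℕ.≤? ⟦ v ⟧ b
    ... | yes va≤vb = distinct-≤⇒< (proj₁ (preserves a b (ℕ.<⇒≤ a<b , va≤vb))) (<⇒≢ a<b ∘′ ⟨$⟩ʳ-injective bij)
    ... | no va≰vb with ℕ.<-cmp (toℕ (φ a)) (toℕ (φ b))
    ...   | tri< φa<φb _ _ = φa<φb
    ...   | tri≈ _ φa≡φb _ = ⊥-elim (<⇒≢ a<b (⟨$⟩ʳ-injective bij (toℕ-injective φa≡φb)))
    ...   | tri> _ _ φb<φa = ⊥-elim (not-¬ refl (trans (sym (proj₁ (W.incomparable-tops (φ b) (φ a) φb<φa φb≁φa)))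
                                                      (trans (agree b) (proj₂ (V.incomparable-tops a b a<b a≁b)))))
      where
      a≁b : ¬ Comparable (v ≼ᴿ_) a b
      a≁b = v-inversion-incomparable a<b va≰vb
      φb≁φa : ¬ Comparable (w ≼ᴿ_) (φ b) (φ a)
      φb≁φa = φ-incomparable a≁b ∘′ swap

    φ≈id⇒v≈w : bij ≈ id → v ≈ w
    φ≈id⇒v≈w φ≈id x = trans (sym (w∘v⁻¹≈id (v ⟨$⟩ʳ x))) (cong (w ⟨$⟩ʳ_) (inverseˡ v))
      where
      w∘v⁻¹-increasing : StrictlyIncreasing (flip v ∘ₚ w)
      w∘v⁻¹-increasing a b a<b with ℕ.<-cmp (toℕ (v ⟨$⟩ˡ a)) (toℕ (v ⟨$⟩ˡ b))
      ... | tri< p<q _ _ = distinct-≤⇒<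
              (subst₂ (λ s t → ⟦ w ⟧ s ≤ ⟦ w ⟧ t) (φ≈id _) (φ≈id _)
                      (proj₂ (preserves _ _ (ℕ.<⇒≤ p<q , subst₂ Fin._≤_ (sym (inverseʳ v)) (sym (inverseʳ v)) (ℕ.<⇒≤ a<b)))))
              (<⇒≢ a<b ∘′ ⟨$⟩ʳ-injective (flip v ∘ₚ w))
      ... | tri≈ _ p≡q _ = ⊥-elim (<⇒≢ a<b (⟨$⟩ʳ-injective (flip v) (toℕ-injective p≡q)))
      ... | tri> _ _ q<p = incomparable⇒inversion w _ _ (ℕ.<⇒≤ q<p)
              (subst₂ (λ s t → ¬ Comparable (w ≼ᴿ_) s t) (φ≈id _) (φ≈id _)
                      (φ-incomparable (inversion⇒incomparable v _ _ q<p
                        (subst₂ _<_ (sym (cong toℕ (inverseʳ v))) (sym (cong toℕ (inverseʳ v))) a<b))))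
      w∘v⁻¹≈id : (flip v ∘ₚ w) ≈ id
      w∘v⁻¹≈id = increasing⇒≈id (flip v ∘ₚ w) w∘v⁻¹-increasing

    wφ-increasing : (∀ x → W.top (φ x) ≡ not (V.top x)) → StrictlyIncreasing (bij ∘ₚ w)
    wφ-increasing disagree a b a<b with ⟦ v ⟧ a ℕ.≤? ⟦ v ⟧ b
    ... | yes va≤vb = distinct-≤⇒< (proj₂ (preserves a b (ℕ.<⇒≤ a<b , va≤vb))) (<⇒≢ a<b ∘′ ⟨$⟩ʳ-injective (bij ∘ₚ w))
    ... | no va≰vb with ℕ.<-cmp (toℕ (φ a)) (toℕ (φ b))
    ...   | tri< φa<φb _ _ = ⊥-elim (not-¬ refl (trans (sym (proj₁ (W.incomparable-tops (φ a) (φ b) φa<φb (φ-incomparable a≁b))))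
                                                      (trans (disagree a) (cong not (proj₁ (V.incomparable-tops a b a<b a≁b))))))
      where
      a≁b : ¬ Comparable (v ≼ᴿ_) a b
      a≁b = v-inversion-incomparable a<b va≰vb
    ...   | tri≈ _ φa≡φb _ = ⊥-elim (<⇒≢ a<b (⟨$⟩ʳ-injective bij (toℕ-injective φa≡φb)))
    ...   | tri> _ _ φb<φa =
      incomparable⇒inversion w (φ b) (φ a) (ℕ.<⇒≤ φb<φa) (φ-incomparable (v-inversion-incomparable a<b va≰vb) ∘′ swap)

    wφ≈id⇒v≈w⁻¹ : (bij ∘ₚ w) ≈ id → v ≈ flip w
    wφ≈id⇒v≈w⁻¹ wφ≈id x = trans (cong (v ⟨$⟩ʳ_) (sym (inverseʳ w))) (v∘w≈id (w ⟨$⟩ˡ x))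
      where
      φw : ∀ y → φ (w ⟨$⟩ʳ y) ≡ y
      φw y = ⟨$⟩ʳ-injective w (wφ≈id (w ⟨$⟩ʳ y))
      v∘w-increasing : StrictlyIncreasing (w ∘ₚ v)
      v∘w-increasing a b a<b with ℕ.<-cmp (⟦ w ⟧ a) (⟦ w ⟧ b)
      ... | tri< wa<wb _ _ = distinct-≤⇒<
              (proj₂ (reflects _ _ (subst₂ (w ≼ᴿ_) (sym (φw a)) (sym (φw b)) (ℕ.<⇒≤ a<b , ℕ.<⇒≤ wa<wb))))
              (<⇒≢ a<b ∘′ ⟨$⟩ʳ-injective (w ∘ₚ v))
      ... | tri≈ _ wa≡wb _ = ⊥-elim (<⇒≢ a<b (⟦⟧-injective w wa≡wb))
      ... | tri> _ _ wb<wa = incomparable⇒inversion v _ _ (ℕ.<⇒≤ wb<wa) λ wb∼wa →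
              inversion⇒incomparable w a b a<b wb<wa (swap (subst₂ (Comparable (w ≼ᴿ_)) (φw b) (φw a) (φ-comparable wb∼wa)))
      v∘w≈id : (w ∘ₚ v) ≈ id
      v∘w≈id = increasing⇒≈id (w ∘ₚ v) v∘w-increasing

  v≈w⊎v≈w⁻¹ : v ≈ w ⊎ v ≈ flip w
  v≈w⊎v≈w⁻¹ with sameWay-trans (sameWay-sym (proj₂ (proj₂ v-unique) V.top V.top-isDecomposition))
                               (proj₂ (proj₂ v-unique) (W.top ∘′ φ)
                                 (λ a b e → Sum.map (reflects a b) (reflects b a) (W.top-isDecomposition (φ a) (φ b) e)))
  ... | inj₁ agree = inj₁ (φ≈id⇒v≈w (increasing⇒≈id bij (φ-increasing agree)))
  ... | inj₂ disagree = inj₂ (wφ≈id⇒v≈w⁻¹ (increasing⇒≈id (bij ∘ₚ w) (wφ-increasing disagree)))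

≈⇒≅ : ∀ {n} {v w : Permutation′ n} → v ≈ w → ℛ v ≅ ℛ w
≈⇒≅ v≈w = record
  { bij = id
  ; preserves = λ x y (x≤y , vx≤vy) → x≤y , subst₂ Fin._≤_ (v≈w x) (v≈w y) vx≤vy
  ; reflects = λ x y (x≤y , wx≤wy) → x≤y , subst₂ Fin._≤_ (sym (v≈w x)) (sym (v≈w y)) wx≤wy }

-- ℛ_{w⁻¹} is ℛ_w with positions and values exchanged, so w⁻¹ itself is an isomorphism.
≈flip⇒≅ : ∀ {n} {v w : Permutation′ n} → v ≈ flip w → ℛ v ≅ ℛ w
≈flip⇒≅ {v = v} {w} v≈w⁻¹ = record
  { bij = v
  ; preserves = λ x y (x≤y , vx≤vy) → vx≤vy , subst₂ Fin._≤_ (sym (wv x)) (sym (wv y)) x≤y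
  ; reflects = λ x y (vx≤vy , wvx≤wvy) → subst₂ Fin._≤_ (wv x) (wv y) wvx≤wvy , vx≤vy }
  where
  wv : ∀ x → w ⟨$⟩ʳ (v ⟨$⟩ʳ x) ≡ x
  wv x = trans (cong (w ⟨$⟩ʳ_) (v≈w⁻¹ x)) (inverseʳ w)

-- Realising 2-chains

module _ {A : Set} {P Q : A → Set} (P? : ∀ x → Dec (P x)) (Q? : ∀ x → Dec (Q x)) (P⇒Q : ∀ {x} → P x → Q x) where

  length-filter-mono : ∀ xs → length (filter P? xs) ≤ length (filter Q? xs)
  length-filter-mono [] = z≤n
  length-filter-mono (x ∷ xs) with P? x | Q? x
  ... | yes _ | yes _ = s≤s (length-filter-mono xs)
  ... | yes p | no ¬q = ⊥-elim (¬q (P⇒Q p))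
  ... | no _ | yes _ = ℕ.m≤n⇒m≤1+n (length-filter-mono xs)
  ... | no _ | no _ = length-filter-mono xs

  length-filter-mono-< : ∀ xs → Any (λ x → Q x × ¬ P x) xs → length (filter P? xs) < length (filter Q? xs)
  length-filter-mono-< (x ∷ xs) (here (q , ¬p)) with P? x | Q? x
  ... | yes p | _ = ⊥-elim (¬p p)
  ... | no _ | yes _ = s≤s (length-filter-mono xs)
  ... | no _ | no ¬q = ⊥-elim (¬q q)
  length-filter-mono-< (x ∷ xs) (there found) with P? x | Q? x
  ... | yes _ | yes _ = s≤s (length-filter-mono-< xs found)
  ... | yes p | no ¬q = ⊥-elim (¬q (P⇒Q p))
  ... | no _ | yes _ = ℕ.<-trans (length-filter-mono-< xs found) (ℕ.n<1+n _)
  ... | no _ | no _ = length-filter-mono-< xs found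

injective⇒surjective : ∀ {n} (f : Fin n → Fin n) → (∀ {x y} → f x ≡ f y → x ≡ y) → ∀ y → ∃ λ x → f x ≡ y
injective⇒surjective {suc n} f f-injective y with any? (λ x → f x ≟ y)
... | yes found = found
... | no none = ⊥-elim (ℕ.<-irrefl refl (injective⇒≤ g-injective))
  where
  g : Fin (suc n) → Fin n
  g x = punchOut {i = y} {j = f x} (λ y≡fx → none (x , sym y≡fx))
  g-injective : ∀ {a b} → g a ≡ g b → a ≡ b
  g-injective {a} {b} e =
    f-injective (punchOut-injective {i = y} (λ y≡fa → none (a , sym y≡fa)) (λ y≡fb → none (b , sym y≡fb)) e)

injective⇒permutation : ∀ {n} (f : Fin n → Fin n) → (∀ {x y} → f x ≡ f y → x ≡ y) →
                        Σ (Permutation′ n) λ π → ∀ x → π ⟨$⟩ʳ x ≡ f x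
injective⇒permutation f f-injective =
  permutation f (λ y → proj₁ (preimage y)) (λ y → proj₂ (preimage y)) (λ x → f-injective (proj₂ (preimage (f x)))) ,
  λ _ → refl
  where
  preimage : ∀ y → ∃ λ x → f x ≡ y
  preimage = injective⇒surjective f f-injective

-- P is the intersection of two linear extensions, which put incomparable points of colour b
-- before those of colour not b, for b = true and b = false; the ranks in the two extensions
-- serve as positions and values of w.
module Realisation {n} (P : FinPoset) (β : FinPoset.Carrier P ↔ Fin n) (twoChain : IsTwoChain P) where
  open FinPoset P using (_≼_; _≼?_; isPartialOrder)
  private
    module ≼ = IsPartialOrder isPartialOrder

    βᵗ : FinPoset.Carrier P → Fin n
    βᵗ = Inverse.to β
    βᶠ : Fin n → FinPoset.Carrier P
    βᶠ = Inverse.from β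

    βᵗβᶠ : ∀ i → βᵗ (βᶠ i) ≡ i
    βᵗβᶠ i = Inverse.inverseˡ β refl
    βᶠβᵗ : ∀ a → βᶠ (βᵗ a) ≡ a
    βᶠβᵗ a = Inverse.inverseʳ β refl

    _⊑_ : Fin n → Fin n → Set
    i ⊑ j = βᶠ i ≼ βᶠ j

    ⊑-antisym : ∀ {i j} → i ⊑ j → j ⊑ i → i ≡ j
    ⊑-antisym p q = trans (sym (βᵗβᶠ _)) (trans (cong βᵗ (≼.antisym p q)) (βᵗβᶠ _))

    ⊑-comparable? : ∀ i j → Dec (Comparable _⊑_ i j)
    ⊑-comparable? i j = (βᶠ i ≼? βᶠ j) ⊎-dec (βᶠ j ≼? βᶠ i)

    colour : Fin n → Bool
    colour i = proj₁ (proj₁ twoChain) (βᶠ i)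

    incomparable⇒opposite : ∀ i j → ¬ Comparable _⊑_ i j → colour i ≡ not (colour j)
    incomparable⇒opposite i j i≁j = ¬-not (λ e → i≁j (proj₁ (proj₂ (proj₁ twoChain)) (βᶠ i) (βᶠ j) e))

  module Extension (b : Bool) where
    _<ᴸ_ : Fin n → Fin n → Set
    i <ᴸ j = (i ⊑ j × i ≢ j) ⊎ (¬ Comparable _⊑_ i j × colour i ≡ b × colour j ≡ not b)

    _<ᴸ?_ : ∀ i j → Dec (i <ᴸ j)
    i <ᴸ? j = ((βᶠ i ≼? βᶠ j) ×-dec ¬? (i ≟ j)) ⊎-dec (¬? (⊑-comparable? i j) ×-dec (colour i ≟ᵇ b) ×-dec (colour j ≟ᵇ not b))

    <ᴸ-irrefl : ∀ i → ¬ (i <ᴸ i)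
    <ᴸ-irrefl i (inj₁ (_ , i≢i)) = i≢i refl
    <ᴸ-irrefl i (inj₂ (i≁i , _)) = i≁i (inj₁ ≼.refl)

    <ᴸ-trans : ∀ {i j k} → i <ᴸ j → j <ᴸ k → i <ᴸ k
    <ᴸ-trans (inj₁ (i⊑j , i≢j)) (inj₁ (j⊑k , _)) = inj₁ (≼.trans i⊑j j⊑k , λ { refl → i≢j (⊑-antisym i⊑j j⊑k) })
    <ᴸ-trans {i} {j} {k} (inj₁ (i⊑j , _)) (inj₂ (j≁k , _ , ck)) with ⊑-comparable? i k
    ... | yes (inj₁ i⊑k) = inj₁ (i⊑k , λ { refl → j≁k (inj₂ i⊑j) })
    ... | yes (inj₂ k⊑i) = ⊥-elim (j≁k (inj₂ (≼.trans k⊑i i⊑j)))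
    ... | no i≁k = inj₂ (i≁k , trans (incomparable⇒opposite i k i≁k) (trans (cong not ck) (not-involutive b)) , ck)
    <ᴸ-trans {i} {j} {k} (inj₂ (i≁j , ci , _)) (inj₁ (j⊑k , _)) with ⊑-comparable? i k
    ... | yes (inj₁ i⊑k) = inj₁ (i⊑k , λ { refl → i≁j (inj₂ j⊑k) })
    ... | yes (inj₂ k⊑i) = ⊥-elim (i≁j (inj₂ (≼.trans j⊑k k⊑i)))
    ... | no i≁k = inj₂ (i≁k , ci , trans (incomparable⇒opposite k i (i≁k ∘′ swap)) (cong not ci))
    <ᴸ-trans (inj₂ (_ , _ , cj)) (inj₂ (_ , cj′ , _)) = ⊥-elim (not-¬ refl (trans (sym cj′) cj))

    <ᴸ-connex : ∀ i j → i ≢ j → i <ᴸ j ⊎ j <ᴸ i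
    <ᴸ-connex i j i≢j with ⊑-comparable? i j
    ... | yes (inj₁ i⊑j) = inj₁ (inj₁ (i⊑j , i≢j))
    ... | yes (inj₂ j⊑i) = inj₂ (inj₁ (j⊑i , i≢j ∘′ sym))
    ... | no i≁j with colour i ≟ᵇ b
    ...   | yes ci = inj₁ (inj₂ (i≁j , ci , trans (incomparable⇒opposite j i (i≁j ∘′ swap)) (cong not ci)))
    ...   | no ci≢b = inj₂ (inj₂ (i≁j ∘′ swap ,
      trans (incomparable⇒opposite j i (i≁j ∘′ swap)) (trans (cong not (¬-not ci≢b)) (not-involutive b)) , ¬-not ci≢b))

    rank : Fin n → ℕ
    rank i = length (filter (_<ᴸ? i) (allFin n))

    rank<n : ∀ i → rank i < n
    rank<n i = subst (rank i <_) (length-tabulate (λ x → x))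
      (filter-notAll (_<ᴸ? i) (allFin n) (Any.map (λ { refl → <ᴸ-irrefl i }) (∈-tabulate⁺ i)))

    rank-mono : ∀ i j → i <ᴸ j → rank i < rank j
    rank-mono i j i<j = length-filter-mono-< (_<ᴸ? i) (_<ᴸ? j) (λ k<i → <ᴸ-trans k<i i<j) (allFin n)
      (Any.map (λ { refl → i<j , <ᴸ-irrefl i }) (∈-tabulate⁺ i))

    -- Abstract: the `with`s on rank comparisons below become very slow if ranking unfolds.
    abstract
      ranking : Σ (Permutation′ n) λ π → ∀ i → π ⟨$⟩ʳ i ≡ fromℕ< (rank<n i)
      ranking = injective⇒permutation (λ i → fromℕ< (rank<n i)) rank-injective
        where
        rank-injective : ∀ {i j} → fromℕ< (rank<n i) ≡ fromℕ< (rank<n j) → i ≡ j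
        rank-injective {i} {j} e with i ≟ j
        ... | yes i≡j = i≡j
        ... | no i≢j = ⊥-elim (case <ᴸ-connex i j i≢j of λ
          { (inj₁ i<j) → ℕ.<-irrefl (same-rank e) (rank-mono i j i<j)
          ; (inj₂ j<i) → ℕ.<-irrefl (sym (same-rank e)) (rank-mono j i j<i) })
          where
          same-rank : fromℕ< (rank<n i) ≡ fromℕ< (rank<n j) → rank i ≡ rank j
          same-rank e = trans (sym (toℕ-fromℕ< _)) (trans (cong toℕ e) (toℕ-fromℕ< _))

    π : Permutation′ n
    π = proj₁ ranking

    ⟦π⟧ : ∀ i → ⟦ π ⟧ i ≡ rank i
    ⟦π⟧ i = trans (cong toℕ (proj₂ ranking i)) (toℕ-fromℕ< _)

    π-preserves : ∀ i j → i ⊑ j → ⟦ π ⟧ i ≤ ⟦ π ⟧ j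
    π-preserves i j i⊑j with i ≟ j
    ... | yes refl = ℕ.≤-refl
    ... | no i≢j = ℕ.<⇒≤ (subst₂ _<_ (sym (⟦π⟧ i)) (sym (⟦π⟧ j)) (rank-mono i j (inj₁ (i⊑j , i≢j))))

    π-reflects : ∀ i j → ⟦ π ⟧ i ≤ ⟦ π ⟧ j → i ≢ j → i <ᴸ j
    π-reflects i j πi≤πj i≢j with <ᴸ-connex i j i≢j
    ... | inj₁ i<j = i<j
    ... | inj₂ j<i = ⊥-elim (ℕ.<⇒≱ (subst₂ _<_ (sym (⟦π⟧ j)) (sym (⟦π⟧ i)) (rank-mono j i j<i)) πi≤πj)

  private
    module L₁ = Extension true
    module L₂ = Extension false

  w : Permutation′ n
  w = flip L₁.π ∘ₚ L₂.π

  private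
    wπ₁ : ∀ i → w ⟨$⟩ʳ (L₁.π ⟨$⟩ʳ i) ≡ L₂.π ⟨$⟩ʳ i
    wπ₁ i = cong (L₂.π ⟨$⟩ʳ_) (inverseˡ L₁.π)

    βᵗ-injective : ∀ {a b} → βᵗ a ≡ βᵗ b → a ≡ b
    βᵗ-injective e = trans (sym (βᶠβᵗ _)) (trans (cong βᶠ e) (βᶠβᵗ _))

    ⊑-βᵗ : ∀ {a b} → a ≼ b → βᵗ a ⊑ βᵗ b
    ⊑-βᵗ = subst₂ _≼_ (sym (βᶠβᵗ _)) (sym (βᶠβᵗ _))

    ≼-βᵗ : ∀ {a b} → βᵗ a ⊑ βᵗ b → a ≼ b
    ≼-βᵗ = subst₂ _≼_ (βᶠβᵗ _) (βᶠβᵗ _)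

  P≅ℛw : P ≅ ℛ w
  P≅ℛw = record
    { bij = L₁.π ↔-∘ β
    ; preserves = λ a b a≼b → L₁.π-preserves _ _ (⊑-βᵗ a≼b) ,
        subst₂ Fin._≤_ (sym (wπ₁ (βᵗ a))) (sym (wπ₁ (βᵗ b))) (L₂.π-preserves _ _ (⊑-βᵗ a≼b))
    ; reflects = reflects }
    where
    reflects : ∀ a b → (w ≼ᴿ (L₁.π ⟨$⟩ʳ βᵗ a)) (L₁.π ⟨$⟩ʳ βᵗ b) → a ≼ b
    reflects a b (π₁a≤π₁b , wπ₁a≤wπ₁b) with βᵗ a ≟ βᵗ b
    ... | yes βa≡βb = ≼.reflexive (βᵗ-injective βa≡βb)
    ... | no βa≢βb with L₁.π-reflects _ _ π₁a≤π₁b βa≢βb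
                      | L₂.π-reflects _ _ (subst₂ Fin._≤_ (wπ₁ (βᵗ a)) (wπ₁ (βᵗ b)) wπ₁a≤wπ₁b) βa≢βb
    ...   | inj₁ (a⊑b , _) | _ = ≼-βᵗ a⊑b
    ...   | inj₂ _ | inj₁ (a⊑b , _) = ≼-βᵗ a⊑b
    ...   | inj₂ (_ , ca≡true , _) | inj₂ (_ , ca≡false , _) = case trans (sym ca≡true) ca≡false of λ ()

twoChain⇒coxeter : ∀ n (w : Permutation′ n) → IsTwoChain (ℛ w) → IsCoxeterElement n w
twoChain⇒coxeter n w = peelable⇒coxeter n w ∘′ coxeterShaped⇒peelable n w ∘′ twoChain⇒coxeterShaped w

coxeter⇒twoChain : ∀ n (w : Permutation′ n) → IsCoxeterElement n w → IsTwoChain (ℛ w)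
coxeter⇒twoChain n w = peelable⇒twoChain n w ∘′ coxeter⇒peelable n w

coxeter⇒avoids321 : ∀ n (w : Permutation′ n) → IsCoxeterElement n w → Avoids321 w
coxeter⇒avoids321 n w = IsCoxeterShaped.avoids321 ∘′ twoChain⇒coxeterShaped w ∘′ coxeter⇒twoChain n w

theorem7p3 :
    -- (1) ℛ_w is a 2-chain iff w is a Coxeter element
    ((n : ℕ) (w : Permutation′ n) →
       (IsTwoChain (ℛ w) → IsCoxeterElement n w) × (IsCoxeterElement n w → IsTwoChain (ℛ w)))
    ×
    -- (2) every n-element 2-chain is isomorphic to ℛ_w for a Coxeter element w
    ((n : ℕ) (P : FinPoset) → (FinPoset.Carrier P ↔ Fin n) → IsTwoChain P →
       Σ (Permutation′ n) λ w → IsCoxeterElement n w × (P ≅ ℛ w))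
    ×
    -- (3) for Coxeter elements v, w: ℛ_v ≅ ℛ_w iff v ∈ {w, w⁻¹}
    ((n : ℕ) (v w : Permutation′ n) → IsCoxeterElement n v → IsCoxeterElement n w →
       ((ℛ v ≅ ℛ w) → (v ≈ w) ⊎ (v ≈ flip w)) × ((v ≈ w) ⊎ (v ≈ flip w) → ℛ v ≅ ℛ w))
theorem7p3 =
  (λ n w → twoChain⇒coxeter n w , coxeter⇒twoChain n w) ,
  (λ n P β twoChain → let open Realisation P β twoChain in
     w , twoChain⇒coxeter n w (isTwoChain-resp-≅ P≅ℛw twoChain) , P≅ℛw) ,
  (λ n v w v-coxeter w-coxeter →
     Rigidity.v≈w⊎v≈w⁻¹ v w (coxeter⇒avoids321 n v v-coxeter) (coxeter⇒avoids321 n w w-coxeter)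
                        (proj₁ (coxeter⇒twoChain n v v-coxeter)) ,
     Sum.[ ≈⇒≅ , ≈flip⇒≅ ])
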